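{- Let $K \geq 1$. Suppose $A_1,A_2,A_3,A_4 \subseteq \mathbb{F}_2^n$ are non-empty, that $(A_1,A_2,A_3,A_4)$ is coherently $\frac{1}{\sqrt{2K}}$-flat, and that $\omega(A_1,A_2,A_3,A_4) \geq 1/K$. Then there is a linear subspace $H \subseteq \mathbb{F}_2^n$ with \[ |H| \geq \frac{4}{5} \prod_{i=1}^4 |A_i|^{1/4},\] together with $x_1,x_2,x_3,x_4 \in \mathbb{F}_2^n$ such that \[ \prod_{i=1}^4 |A_i \cap (x_i + H)|^{1/4} \geq \frac{1}{2K}|H|.\]
   Context: $\mathbb{F}_2^n$ is the $n$-dimensional vector space over the two-element field. For $f:\mathbb{F}_2^n\to\mathbb{R}$, $\hat f(\xi) := 2^{ -n}\sum_{x\in\mathbb{F}_2^n} f(x)(-1)^{\xi\cdot x}$, where $x\cdot\xi=\sum_i x_i\xi_i$. For non-empty $A\subseteq\mathbb{F}_2^n$ and $0<\alpha\le 1$, $\mathrm{Spec}_\alpha(A)$ is the set of $\xi\in\mathbb{F}_2^n$ with $|\hat 1_A(\xi)| \geq \alpha|A|/2^n$. For $\delta>0$, a quadruple of non-empty sets $(A_1,A_2,A_3,A_4)$ is coherently $\delta$-flat if for every $\xi\in\mathbb{F}_2^n$ either $\xi\in\mathrm{Spec}_{9/10}(A_i)$ for all $i=1,2,3,4$, or $\xi\notin\mathrm{Spec}_\delta(A_i)$ for all $i=1,2,3,4$. The normalised energy is \[\omega(A_1,A_2,A_3,A_4) := \frac{|\{ (a_1,\dots,a_4) \in A_1 \times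 \cdots \times A_4 : a_1 + a_2 + a_3 + a_4 = 0 \}|}{(|A_1| |A_2| |A_3| |A_4|)^{3/4}}.\]
   Formalization: The parameter K ranges over the rationals. -}

module Defs where

open import Data.Bool using (Bool; true; false; _∧_; _xor_; not; if_then_else_)
open import Data.Nat using (ℕ; zero; suc)
import Data.Nat as ℕ
open import Data.Integer using (ℤ; +_; -[1+_])
import Data.Integer as ℤ
open import Data.Rational using (ℚ; _/_; _≤_; _*_)
open import Data.List using (List; []; _∷_; _++_; map; foldr; concatMap)
open import Data.Vec using (Vec; []; _∷_; zipWith; replicate)
open import Relation.Binary.PropositionalEquality using (_≡_)
open import Relation.Nullary using (¬_)
open import Data.Product using (_×_)

𝔽₂^ : ℕ → Set
𝔽₂^ n = Vec Bool n

_⊕_ : ∀ {n} → 𝔽₂^ n → 𝔽₂^ n → 𝔽₂^ n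
x ⊕ y = zipWith _xor_ x y

𝟎 : ∀ {n} → 𝔽₂^ n
𝟎 {n} = replicate n false

dot : ∀ {n} → 𝔽₂^ n → 𝔽₂^ n → Bool
dot [] [] = false
dot (a ∷ x) (b ∷ y) = (a ∧ b) xor dot x y

eqBits : ∀ {n} → 𝔽₂^ n → 𝔽₂^ n → Bool
eqBits [] [] = true
eqBits (true ∷ x) (true ∷ y) = eqBits x y
eqBits (false ∷ x) (false ∷ y) = eqBits x y
eqBits _ _ = false

allVecs : (n : ℕ) → List (𝔽₂^ n)
allVecs zero = [] ∷ []
allVecs (suc n) = map (false ∷_) (allVecs n) ++ map (true ∷_) (allVecs n)

Subset : ℕ → Set
Subset n = 𝔽₂^ n → Bool

b2n : Bool → ℕ
b2n true = 1
b2n false = 0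

sumℕ : ∀ {A : Set} → List A → (A → ℕ) → ℕ
sumℕ xs f = foldr (λ x acc → f x ℕ.+ acc) 0 xs

sumℤ : ∀ {A : Set} → List A → (A → ℤ) → ℤ
sumℤ xs f = foldr (λ x acc → f x ℤ.+ acc) (+ 0) xs

card : ∀ {n} → Subset n → ℕ
card {n} A = sumℕ (allVecs n) (λ x → b2n (A x))

NonEmpty : ∀ {n} → Subset n → Set
NonEmpty A = 1 ℕ.≤ card A

-- 2ⁿ · \hat{1_A}(ξ) = Σ_{x ∈ A} (-1)^{ξ·x}   (an integer)
fourierSum : ∀ {n} → Subset n → 𝔽₂^ n → ℤ
fourierSum {n} A ξ =
  sumℤ (allVecs n) (λ x → if A x then (if dot ξ x then ℤ.- (+ 1) else + 1) else + 0)

ℕtoℚ : ℕ → ℚ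
ℕtoℚ m = (+ m) / 1

ℤtoℚ : ℤ → ℚ
ℤtoℚ z = z / 1

-- ξ ∈ Spec_α(A), where the parameter passed is α² (α > 0):
--   |\hat 1_A(ξ)| ≥ α|A|/2ⁿ  ⇔  |fourierSum A ξ| ≥ α|A|  ⇔  α²|A|² ≤ (fourierSum A ξ)²
-- (both sides non-negative, so squaring is an equivalence).
InSpec² : ∀ {n} → (α² : ℚ) → Subset n → 𝔽₂^ n → Set
InSpec² α² A ξ = α² * (ℕtoℚ (card A) * ℕtoℚ (card A))
                   ≤ ℤtoℚ (fourierSum A ξ) * ℤtoℚ (fourierSum A ξ)

InSpec910 : ∀ {n} → Subset n → 𝔽₂^ n → Set
InSpec910 = InSpec² ((+ 81) / 100)

CoherentlyFlat² : ∀ {n} → (δ² : ℚ) → (A₁ A₂ A₃ A₄ : Subset n) → Set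
CoherentlyFlat² {n} δ² A₁ A₂ A₃ A₄ = (ξ : 𝔽₂^ n) →
  (InSpec910 A₁ ξ × InSpec910 A₂ ξ × InSpec910 A₃ ξ × InSpec910 A₄ ξ)
  Data.Sum.⊎
  (¬ InSpec² δ² A₁ ξ × ¬ InSpec² δ² A₂ ξ × ¬ InSpec² δ² A₃ ξ × ¬ InSpec² δ² A₄ ξ)
  where import Data.Sum

energyCount : ∀ {n} → (A₁ A₂ A₃ A₄ : Subset n) → ℕ
energyCount {n} A₁ A₂ A₃ A₄ =
  sumℕ (allVecs n) λ a₁ → sumℕ (allVecs n) λ a₂ →
  sumℕ (allVecs n) λ a₃ → sumℕ (allVecs n) λ a₄ →
  b2n (A₁ a₁ ∧ A₂ a₂ ∧ A₃ a₃ ∧ A₄ a₄ ∧ eqBits (a₁ ⊕ (a₂ ⊕ (a₃ ⊕ a₄))) 𝟎)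

pow4 : ℚ → ℚ
pow4 q = q * q * q * q

-- ω(A₁,…,A₄) ≥ 1/K   with K > 0, i.e.  E/(P)^{3/4} ≥ 1/K  ⇔  P³ ≤ K⁴ E⁴
-- where E = energyCount, P = |A₁||A₂||A₃||A₄|.
ωAtLeastInv : ∀ {n} → (K : ℚ) → (A₁ A₂ A₃ A₄ : Subset n) → Set
ωAtLeastInv K A₁ A₂ A₃ A₄ =
  let P = ℕtoℚ (card A₁ ℕ.* card A₂ ℕ.* card A₃ ℕ.* card A₄)
      E = ℕtoℚ (energyCount A₁ A₂ A₃ A₄)
  in P * P * P ≤ pow4 K * pow4 E

-- linear subspace of 𝔽₂ⁿ (over 𝔽₂ closure under scalars is automatic)
record IsSubspace {n} (H : Subset n) : Set where
  field
    zero-mem : H 𝟎 ≡ true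
    add-mem  : ∀ x y → H x ≡ true → H y ≡ true → H (x ⊕ y) ≡ true

-- A ∩ (x + H)  (y ∈ x + H  ⇔  y + x ∈ H)
interCoset : ∀ {n} → Subset n → 𝔽₂^ n → Subset n → Subset n
interCoset A x H y = A y ∧ H (y ⊕ x)

{-# OPTIONS --safe #-}
module Submission where

-- Let F_A(ξ) = Σ_{x∈A} (-1)^{ξ·x} and V = Spec_{9/10}(A₁). Since δ² = 1/(2K) ≤ 16/25, coherent flatness
-- makes V the common large spectrum of A₁,…,A₄ and puts every ξ ∉ V outside all four Spec_δ(A_i).
-- From |F(ξ)| + |F(η)| ≤ |A| + |F(ξ+η)|, two frequencies of V add up to one of Spec_{4/5}(A₁) ⊆ Spec_δ(A₁),
-- hence back into V: V is a subspace, and H := V^⊥. Restricting Parseval to V gives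
--   Σ_{ξ∈V} F_A(ξ)² = |V| Σ_{x∈A} |A ∩ (x+H)|,
-- which forces |H| ≥ (81/100)|A_i| and bounds Σ_{ξ∈V} F_{A_i}(ξ)⁴ by |V||A_i|³ max_x |A_i ∩ (x+H)|.
-- Now split 2ⁿ·E = Σ_ξ F₁F₂F₃F₄ into the parts on V and off V. By Hölder and F² < δ²|A|² off V, the part
-- off V has fourth power at most δ⁸ 2⁴ⁿ Π|A_i|³, which by ω ≥ 1/K is at most (2ⁿE)⁴/16; so it is at most
-- half of 2ⁿE, and (2ⁿE)⁴ ≤ 16·(part on V)⁴. Hölder on V and |V||H| = 2ⁿ then give
-- |H|⁴ ≤ (2K)⁴ Π_i max_x |A_i ∩ (x+H)|.

open import Defs
open import Data.Bool using (Bool; true; false; _∧_; _xor_; not; if_then_else_)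
import Data.Bool.Properties as Boolₚ
open import Data.Nat using (ℕ; zero; suc)
import Data.Nat as ℕ
import Data.Nat.Properties as ℕₚ
open import Data.Integer as ℤ using (ℤ; +_; -[1+_]; +≤+; +<+; -≤+)
import Data.Integer.Properties as ℤₚ
open import Data.Rational as ℚ using (ℚ; 1ℚ; 0ℚ)
import Data.Rational.Properties as ℚₚ
open import Data.List using ([]; _∷_; _++_; map)
open import Data.List.Membership.Propositional using (_∈_)
open import Data.List.Membership.Propositional.Properties using (∈-map⁺; ∈-++⁺ˡ; ∈-++⁺ʳ)
open import Data.List.Relation.Unary.Any using (here)
open import Data.Vec using ([]; _∷_)
open import Data.Product using (Σ; ∃; _,_; proj₁; proj₂; _×_)
open import Data.Sum using ([_,_]′)
open import Data.Empty using (⊥-elim)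
open import Function using (_∘_; _⟨_⟩_; id)
open import Relation.Nullary using (¬_)
open import Relation.Binary.PropositionalEquality
  using (_≡_; _≢_; refl; sym; trans; cong; cong₂; subst; subst₂; module ≡-Reasoning)
open import Algebra.Bundles using (CommutativeRing; CommutativeMonoid)
import Algebra.Properties.CommutativeSemigroup as CommSemigroupₚ

module FiniteSums where

  open import Data.Integer using (_+_; _*_; -_; _≤_; 0ℤ)
  open CommSemigroupₚ ℤₚ.+-commutativeSemigroup using () renaming (interchange to +-interchange)

  module _ {X : Set} where

    sumℤ-cong : ∀ xs {f g : X → ℤ} → (∀ x → f x ≡ g x) → sumℤ xs f ≡ sumℤ xs g
    sumℤ-cong []       f≡g = refl
    sumℤ-cong (x ∷ xs) f≡g = cong₂ _+_ (f≡g x) (sumℤ-cong xs f≡g)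

    sumℤ-zero : ∀ xs → sumℤ xs (λ (_ : X) → 0ℤ) ≡ 0ℤ
    sumℤ-zero []       = refl
    sumℤ-zero (x ∷ xs) = ℤₚ.+-identityˡ _ ⟨ trans ⟩ sumℤ-zero xs

    sumℤ-+ : ∀ xs (f g : X → ℤ) → sumℤ xs (λ x → f x + g x) ≡ sumℤ xs f + sumℤ xs g
    sumℤ-+ []       f g = refl
    sumℤ-+ (x ∷ xs) f g rewrite sumℤ-+ xs f g = +-interchange (f x) (g x) (sumℤ xs f) (sumℤ xs g)

    sumℤ-*ˡ : ∀ xs c (f : X → ℤ) → sumℤ xs (λ x → c * f x) ≡ c * sumℤ xs f
    sumℤ-*ˡ []       c f = sym (ℤₚ.*-zeroʳ c)
    sumℤ-*ˡ (x ∷ xs) c f rewrite sumℤ-*ˡ xs c f = sym (ℤₚ.*-distribˡ-+ c (f x) (sumℤ xs f))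

    sumℤ-*ʳ : ∀ xs c (f : X → ℤ) → sumℤ xs (λ x → f x * c) ≡ sumℤ xs f * c
    sumℤ-*ʳ xs c f = sumℤ-cong xs (λ x → ℤₚ.*-comm (f x) c) ⟨ trans ⟩ sumℤ-*ˡ xs c f ⟨ trans ⟩ ℤₚ.*-comm c _

    sumℤ-neg : ∀ xs (f : X → ℤ) → sumℤ xs (λ x → - f x) ≡ - sumℤ xs f
    sumℤ-neg []       f = refl
    sumℤ-neg (x ∷ xs) f rewrite sumℤ-neg xs f = sym (ℤₚ.neg-distrib-+ (f x) (sumℤ xs f))

    sumℤ-++ : ∀ xs ys (f : X → ℤ) → sumℤ (xs ++ ys) f ≡ sumℤ xs f + sumℤ ys f
    sumℤ-++ []       ys f = sym (ℤₚ.+-identityˡ _)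
    sumℤ-++ (x ∷ xs) ys f rewrite sumℤ-++ xs ys f = sym (ℤₚ.+-assoc (f x) _ _)

    sumℤ-mono-≤ : ∀ xs {f g : X → ℤ} → (∀ x → f x ≤ g x) → sumℤ xs f ≤ sumℤ xs g
    sumℤ-mono-≤ []       f≤g = ℤₚ.≤-refl
    sumℤ-mono-≤ (x ∷ xs) f≤g = ℤₚ.+-mono-≤ (f≤g x) (sumℤ-mono-≤ xs f≤g)

    sumℤ-nonNeg : ∀ xs {f : X → ℤ} → (∀ x → 0ℤ ≤ f x) → 0ℤ ≤ sumℤ xs f
    sumℤ-nonNeg xs {f} 0≤f = subst (_≤ sumℤ xs f) (sumℤ-zero xs) (sumℤ-mono-≤ xs 0≤f)

    +-sumℕ : ∀ xs (f : X → ℕ) → + sumℕ xs f ≡ sumℤ xs (+_ ∘ f)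
    +-sumℕ []       f = refl
    +-sumℕ (x ∷ xs) f = ℤₚ.pos-+ (f x) (sumℕ xs f) ⟨ trans ⟩ cong (_+_ (+ f x)) (+-sumℕ xs f)

    sumℤ-*⁴ : ∀ xs (f₁ f₂ f₃ f₄ : X → ℤ) →
              sumℤ xs f₁ * sumℤ xs f₂ * sumℤ xs f₃ * sumℤ xs f₄
              ≡ sumℤ xs λ a → sumℤ xs λ b → sumℤ xs λ c → sumℤ xs λ d → f₁ a * f₂ b * f₃ c * f₄ d
    sumℤ-*⁴ xs f₁ f₂ f₃ f₄ = begin
      S f₁ * S f₂ * S f₃ * S f₄
        ≡⟨ cong (λ t → t * S f₃ * S f₄) (sumℤ-*ʳ xs (S f₂) f₁) ⟨
      S (λ a → f₁ a * S f₂) * S f₃ * S f₄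
        ≡⟨ pull (λ a → f₁ a * S f₂) (S f₃) (S f₄) ⟩
      S (λ a → f₁ a * S f₂ * S f₃ * S f₄)
        ≡⟨ sumℤ-cong xs (λ a → cong (λ t → t * S f₃ * S f₄) (sym (sumℤ-*ˡ xs (f₁ a) f₂))
                               ⟨ trans ⟩ pull (λ b → f₁ a * f₂ b) (S f₃) (S f₄)) ⟩
      S (λ a → S λ b → f₁ a * f₂ b * S f₃ * S f₄)
        ≡⟨ sumℤ-cong xs (λ a → sumℤ-cong xs (λ b →
             cong (_* S f₄) (sym (sumℤ-*ˡ xs (f₁ a * f₂ b) f₃))
             ⟨ trans ⟩ sym (sumℤ-*ʳ xs (S f₄) (λ c → f₁ a * f₂ b * f₃ c)))) ⟩
      S (λ a → S λ b → S λ c → f₁ a * f₂ b * f₃ c * S f₄)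
        ≡⟨ sumℤ-cong xs (λ a → sumℤ-cong xs (λ b → sumℤ-cong xs (λ c → sumℤ-*ˡ xs (f₁ a * f₂ b * f₃ c) f₄))) ⟨
      S (λ a → S λ b → S λ c → S λ d → f₁ a * f₂ b * f₃ c * f₄ d) ∎
      where
      open ≡-Reasoning
      S : (X → ℤ) → ℤ
      S = sumℤ xs
      pull : ∀ (g : X → ℤ) c d → S g * c * d ≡ S (λ x → g x * c * d)
      pull g c d = cong (_* d) (sym (sumℤ-*ʳ xs c g)) ⟨ trans ⟩ sym (sumℤ-*ʳ xs d (λ x → g x * c))

  module _ {X Y : Set} where

    sumℤ-map : ∀ xs (h : X → Y) (f : Y → ℤ) → sumℤ (map h xs) f ≡ sumℤ xs (f ∘ h)
    sumℤ-map []       h f = refl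
    sumℤ-map (x ∷ xs) h f = cong (_+_ (f (h x))) (sumℤ-map xs h f)

    sumℤ-swap : ∀ xs ys (f : X → Y → ℤ) →
                sumℤ xs (λ x → sumℤ ys (f x)) ≡ sumℤ ys (λ y → sumℤ xs (λ x → f x y))
    sumℤ-swap []       ys f = sym (sumℤ-zero ys)
    sumℤ-swap (x ∷ xs) ys f rewrite sumℤ-swap xs ys f = sym (sumℤ-+ ys (f x) _)

    sumℤ-*-sumℤ : ∀ xs ys (f : X → ℤ) (g : Y → ℤ) →
                  sumℤ xs f * sumℤ ys g ≡ sumℤ xs (λ x → sumℤ ys (λ y → f x * g y))
    sumℤ-*-sumℤ xs ys f g =
      sym (sumℤ-*ʳ xs (sumℤ ys g) f) ⟨ trans ⟩ sumℤ-cong xs (λ x → sym (sumℤ-*ˡ ys (f x) g))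

open FiniteSums

module BooleanCube where

  open import Data.Integer using (_+_; _*_; -_; 0ℤ; 1ℤ; -1ℤ)
  open import Data.Vec.Properties using (zipWith-assoc; zipWith-comm; zipWith-identityʳ)
  open CommSemigroupₚ (CommutativeRing.+-commutativeSemigroup Boolₚ.xor-∧-commutativeRing)
    using () renaming (interchange to xor-interchange)

  ⊕-assoc : ∀ {n} (x y z : 𝔽₂^ n) → (x ⊕ y) ⊕ z ≡ x ⊕ (y ⊕ z)
  ⊕-assoc = zipWith-assoc Boolₚ.xor-assoc

  ⊕-comm : ∀ {n} (x y : 𝔽₂^ n) → x ⊕ y ≡ y ⊕ x
  ⊕-comm = zipWith-comm Boolₚ.xor-comm

  ⊕-identityʳ : ∀ {n} (x : 𝔽₂^ n) → x ⊕ 𝟎 ≡ x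
  ⊕-identityʳ = zipWith-identityʳ Boolₚ.xor-identityʳ

  ⊕-identityˡ : ∀ {n} (x : 𝔽₂^ n) → 𝟎 ⊕ x ≡ x
  ⊕-identityˡ x = ⊕-comm 𝟎 x ⟨ trans ⟩ ⊕-identityʳ x

  ⊕-same : ∀ {n} (x : 𝔽₂^ n) → x ⊕ x ≡ 𝟎
  ⊕-same []      = refl
  ⊕-same (b ∷ x) = cong₂ _∷_ (Boolₚ.xor-same b) (⊕-same x)

  ⊕-cancelʳ : ∀ {n} (x y : 𝔽₂^ n) → (x ⊕ y) ⊕ y ≡ x
  ⊕-cancelʳ x y = ⊕-assoc x y y ⟨ trans ⟩ cong (x ⊕_) (⊕-same y) ⟨ trans ⟩ ⊕-identityʳ x

  dot-comm : ∀ {n} (ξ x : 𝔽₂^ n) → dot ξ x ≡ dot x ξ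
  dot-comm []      []      = refl
  dot-comm (a ∷ ξ) (b ∷ x) = cong₂ _xor_ (Boolₚ.∧-comm a b) (dot-comm ξ x)

  dot-distribʳ-⊕ : ∀ {n} (ξ x y : 𝔽₂^ n) → dot ξ (x ⊕ y) ≡ dot ξ x xor dot ξ y
  dot-distribʳ-⊕ []      []      []      = refl
  dot-distribʳ-⊕ (a ∷ ξ) (b ∷ x) (c ∷ y) =
    cong₂ _xor_ (Boolₚ.∧-distribˡ-xor a b c) (dot-distribʳ-⊕ ξ x y)
    ⟨ trans ⟩ xor-interchange (a ∧ b) (a ∧ c) (dot ξ x) (dot ξ y)

  dot-distribˡ-⊕ : ∀ {n} (ξ η x : 𝔽₂^ n) → dot (ξ ⊕ η) x ≡ dot ξ x xor dot η x
  dot-distribˡ-⊕ ξ η x =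
    dot-comm (ξ ⊕ η) x ⟨ trans ⟩ dot-distribʳ-⊕ x ξ η ⟨ trans ⟩ cong₂ _xor_ (dot-comm x ξ) (dot-comm x η)

  dot-zeroʳ : ∀ {n} (ξ : 𝔽₂^ n) → dot ξ 𝟎 ≡ false
  dot-zeroʳ []      = refl
  dot-zeroʳ (a ∷ ξ) = cong (_xor dot ξ 𝟎) (Boolₚ.∧-zeroʳ a) ⟨ trans ⟩ dot-zeroʳ ξ

  ∈-allVecs : ∀ {n} (x : 𝔽₂^ n) → x ∈ allVecs n
  ∈-allVecs []          = here refl
  ∈-allVecs (false ∷ x) = ∈-++⁺ˡ (∈-map⁺ (false ∷_) (∈-allVecs x))
  ∈-allVecs (true ∷ x)  = ∈-++⁺ʳ (map (false ∷_) (allVecs _)) (∈-map⁺ (true ∷_) (∈-allVecs x))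

  𝟙 : Bool → ℤ
  𝟙 b = + b2n b

  2^_ : ℕ → ℤ
  2^ n = + (2 ℕ.^ n)

  ∑ : ∀ {n} → (𝔽₂^ n → ℤ) → ℤ
  ∑ {n} = sumℤ (allVecs n)

  infixr 6.5 ∑
  syntax ∑ (λ x → e) = ∑[ x ] e

  ∑-split : ∀ {n} (f : 𝔽₂^ (suc n) → ℤ) → ∑ f ≡ ∑ (f ∘ (false ∷_)) + ∑ (f ∘ (true ∷_))
  ∑-split {n} f =
    sumℤ-++ (map (false ∷_) (allVecs n)) _ f
    ⟨ trans ⟩ cong₂ _+_ (sumℤ-map (allVecs n) (false ∷_) f) (sumℤ-map (allVecs n) (true ∷_) f)

  ∑-translate : ∀ {n} (c : 𝔽₂^ n) (f : 𝔽₂^ n → ℤ) → ∑[ x ] f (x ⊕ c) ≡ ∑ f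
  ∑-translate []          f = refl
  ∑-translate (false ∷ c) f = begin
    ∑[ x ] f (x ⊕ (false ∷ c))                            ≡⟨ ∑-split (λ x → f (x ⊕ (false ∷ c))) ⟩
    ∑[ x ] f (false ∷ x ⊕ c) + ∑[ x ] f (true ∷ x ⊕ c)   ≡⟨ cong₂ _+_ (∑-translate c (f ∘ (false ∷_)))
                                                                      (∑-translate c (f ∘ (true ∷_))) ⟩
    ∑[ x ] f (false ∷ x) + ∑[ x ] f (true ∷ x)           ≡⟨ ∑-split f ⟨
    ∑ f                                                   ∎
    where open ≡-Reasoning
  ∑-translate (true ∷ c)  f = begin
    ∑[ x ] f (x ⊕ (true ∷ c))                             ≡⟨ ∑-split (λ x → f (x ⊕ (true ∷ c))) ⟩
    ∑[ x ] f (true ∷ x ⊕ c) + ∑[ x ] f (false ∷ x ⊕ c)   ≡⟨ cong₂ _+_ (∑-translate c (f ∘ (true ∷_)))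
                                                                      (∑-translate c (f ∘ (false ∷_))) ⟩
    ∑[ x ] f (true ∷ x) + ∑[ x ] f (false ∷ x)           ≡⟨ ℤₚ.+-comm (∑[ x ] f (true ∷ x)) _ ⟩
    ∑[ x ] f (false ∷ x) + ∑[ x ] f (true ∷ x)           ≡⟨ ∑-split f ⟨
    ∑ f                                                   ∎
    where open ≡-Reasoning

  ∑-indicator-𝟎 : ∀ {n} (g : 𝔽₂^ n → ℤ) → ∑[ ξ ] 𝟙 (eqBits ξ 𝟎) * g ξ ≡ g 𝟎
  ∑-indicator-𝟎 {zero}  g = ℤₚ.+-identityʳ _ ⟨ trans ⟩ ℤₚ.*-identityˡ (g [])
  ∑-indicator-𝟎 {suc n} g = begin
    ∑[ ξ ] 𝟙 (eqBits ξ 𝟎) * g ξ                                    ≡⟨ ∑-split (λ ξ → 𝟙 (eqBits ξ 𝟎) * g ξ) ⟩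
    ∑[ ξ ] 𝟙 (eqBits ξ 𝟎) * g (false ∷ ξ) + ∑[ ξ ] 0ℤ * g (true ∷ ξ) ≡⟨ cong₂ _+_ (∑-indicator-𝟎 (g ∘ (false ∷_)))
                                                                              (sumℤ-zero (allVecs n)) ⟩
    g 𝟎 + 0ℤ                                                         ≡⟨ ℤₚ.+-identityʳ _ ⟩
    g 𝟎                                                              ∎
    where open ≡-Reasoning

  sign : Bool → ℤ
  sign b = if b then -1ℤ else 1ℤ

  sign-xor : ∀ a b → sign (a xor b) ≡ sign a * sign b
  sign-xor false b     = sym (ℤₚ.*-identityˡ (sign b))
  sign-xor true  false = refl
  sign-xor true  true  = refl

  sign-not : ∀ b → sign (not b) ≡ - sign b
  sign-not false = refl
  sign-not true  = refl

  sign-*-≤-∣∣ : ∀ e z → sign e * z ℤ.≤ + ℤ.∣ z ∣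
  sign-*-≤-∣∣ false (+ n)    = ℤₚ.≤-reflexive (ℤₚ.*-identityˡ (+ n))
  sign-*-≤-∣∣ false -[1+ n ] = subst (ℤ._≤ + suc n) (sym (ℤₚ.*-identityˡ -[1+ n ])) -≤+
  sign-*-≤-∣∣ true  (+ n)    = subst (ℤ._≤ + n) (sym (ℤₚ.-1*i≡-i (+ n))) ℤₚ.neg-≤-pos
  sign-*-≤-∣∣ true  -[1+ n ] = ℤₚ.≤-reflexive (ℤₚ.-1*i≡-i -[1+ n ])

  sign-*-∣∣ : ∀ z → ∃ λ e → sign e * z ≡ + ℤ.∣ z ∣
  sign-*-∣∣ (+ n)    = false , ℤₚ.*-identityˡ (+ n)
  sign-*-∣∣ -[1+ n ] = true , ℤₚ.-1*i≡-i -[1+ n ]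

  χ : ∀ {n} → 𝔽₂^ n → 𝔽₂^ n → ℤ
  χ ξ x = sign (dot ξ x)

  χ-comm : ∀ {n} (ξ x : 𝔽₂^ n) → χ ξ x ≡ χ x ξ
  χ-comm ξ x = cong sign (dot-comm ξ x)

  χ-⊕ʳ : ∀ {n} (ξ x y : 𝔽₂^ n) → χ ξ (x ⊕ y) ≡ χ ξ x * χ ξ y
  χ-⊕ʳ ξ x y = cong sign (dot-distribʳ-⊕ ξ x y) ⟨ trans ⟩ sign-xor (dot ξ x) (dot ξ y)

  χ-⊕ˡ : ∀ {n} (ξ η x : 𝔽₂^ n) → χ (ξ ⊕ η) x ≡ χ ξ x * χ η x
  χ-⊕ˡ ξ η x = trans (cong sign (dot-distribˡ-⊕ ξ η x)) (sign-xor (dot ξ x) (dot η x))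

  χ-zeroʳ : ∀ {n} (ξ : 𝔽₂^ n) → χ ξ 𝟎 ≡ 1ℤ
  χ-zeroʳ ξ = cong sign (dot-zeroʳ ξ)

  2^-suc : ∀ n → 2^ suc n ≡ 2^ n + 2^ n
  2^-suc n = cong +_ (cong (2 ℕ.^ n ℕ.+_) (ℕₚ.+-identityʳ (2 ℕ.^ n))) ⟨ trans ⟩ ℤₚ.pos-+ (2 ℕ.^ n) (2 ℕ.^ n)

  ∑-χ : ∀ {n} (z : 𝔽₂^ n) → ∑[ ξ ] χ ξ z ≡ 2^ n * 𝟙 (eqBits z 𝟎)
  ∑-χ []          = refl
  ∑-χ {suc n} (false ∷ z) = begin
    ∑[ ξ ] χ ξ (false ∷ z)                                   ≡⟨ ∑-split (λ ξ → χ ξ (false ∷ z)) ⟩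
    ∑[ ξ ] χ ξ z + ∑[ ξ ] χ ξ z                              ≡⟨ cong₂ _+_ (∑-χ z) (∑-χ z) ⟩
    2^ n * 𝟙 (eqBits z 𝟎) + 2^ n * 𝟙 (eqBits z 𝟎)           ≡⟨ ℤₚ.*-distribʳ-+ (𝟙 (eqBits z 𝟎)) (2^ n) (2^ n) ⟨
    (2^ n + 2^ n) * 𝟙 (eqBits z 𝟎)                           ≡⟨ cong (_* 𝟙 (eqBits z 𝟎)) (2^-suc n) ⟨
    2^ suc n * 𝟙 (eqBits z 𝟎)                                ∎
    where open ≡-Reasoning
  ∑-χ {suc n} (true ∷ z)  = begin
    ∑[ ξ ] χ ξ (true ∷ z)                                    ≡⟨ ∑-split (λ ξ → χ ξ (true ∷ z)) ⟩
    ∑[ ξ ] χ ξ z + ∑[ ξ ] sign (not (dot ξ z))               ≡⟨ cong (_+_ (∑[ ξ ] χ ξ z))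
                                                                     (sumℤ-cong (allVecs n) (λ ξ → sign-not (dot ξ z))) ⟩
    ∑[ ξ ] χ ξ z + ∑[ ξ ] - χ ξ z                            ≡⟨ cong (_+_ (∑[ ξ ] χ ξ z)) (sumℤ-neg (allVecs n) (λ ξ → χ ξ z)) ⟩
    ∑[ ξ ] χ ξ z + - (∑[ ξ ] χ ξ z)                          ≡⟨ ℤₚ.+-inverseʳ (∑[ ξ ] χ ξ z) ⟩
    0ℤ                                                       ≡⟨ ℤₚ.*-zeroʳ (2^ suc n) ⟨
    2^ suc n * 0ℤ                                            ∎
    where open ≡-Reasoning

open BooleanCube

module NatArithmetic where

  open import Data.Nat using (_+_; _*_; _≤_)
  open import Data.Nat.Tactic.RingSolver using (solve-∀)

  ≤-of-²≤² : ∀ {x y} → x * x ≤ y * y → x ≤ y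
  ≤-of-²≤² x²≤y² = ℕₚ.≮⇒≥ (λ y<x → ℕₚ.<⇒≱ (ℕₚ.*-mono-< y<x y<x) x²≤y²)

  ≤-of-⁴≤⁴ : ∀ {x y} → x * x * x * x ≤ y * y * y * y → x ≤ y
  ≤-of-⁴≤⁴ x⁴≤y⁴ = ℕₚ.≮⇒≥ (λ y<x → ℕₚ.<⇒≱ (ℕₚ.*-mono-< (ℕₚ.*-mono-< (ℕₚ.*-mono-< y<x y<x) y<x) y<x) x⁴≤y⁴)

  ≥9/10∧≥9/10⇒≥8/10 : ∀ a b c d → 81 * (c * c) ≤ 100 * (a * a) → 81 * (c * c) ≤ 100 * (b * b) →
                          a + b ≤ c + d → 64 * (c * c) ≤ 100 * (d * d)
  ≥9/10∧≥9/10⇒≥8/10 a b c d 81c²≤100a² 81c²≤100b² a+b≤c+d =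
    subst₂ _≤_ (scale 8 c) (scale 10 d) (ℕₚ.*-mono-≤ 8c≤10d 8c≤10d)
    where
    scale : ∀ k x → (k * x) * (k * x) ≡ (k * k) * (x * x)
    scale = solve-∀
    root : ∀ x → 81 * (c * c) ≤ 100 * (x * x) → 9 * c ≤ 10 * x
    root x 81c²≤100x² = ≤-of-²≤² (subst₂ _≤_ (sym (scale 9 c)) (sym (scale 10 x)) 81c²≤100x²)
    18c≤10c+10d : 10 * c + 8 * c ≤ 10 * c + 10 * d
    18c≤10c+10d = begin
      10 * c + 8 * c    ≡⟨ nine-nine c ⟨
      9 * c + 9 * c     ≤⟨ ℕₚ.+-mono-≤ (root a 81c²≤100a²) (root b 81c²≤100b²) ⟩
      10 * a + 10 * b   ≡⟨ ℕₚ.*-distribˡ-+ 10 a b ⟨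
      10 * (a + b)      ≤⟨ ℕₚ.*-monoʳ-≤ 10 a+b≤c+d ⟩
      10 * (c + d)      ≡⟨ ℕₚ.*-distribˡ-+ 10 c d ⟩
      10 * c + 10 * d   ∎
      where
      open ℕₚ.≤-Reasoning
      nine-nine : ∀ c → 9 * c + 9 * c ≡ 10 * c + 8 * c
      nine-nine = solve-∀
    8c≤10d : 8 * c ≤ 10 * d
    8c≤10d = ℕₚ.+-cancelˡ-≤ (10 * c) (8 * c) (10 * d) 18c≤10c+10d

  four-fifths⁴ : ∀ a₁ a₂ a₃ a₄ h → 81 * a₁ ≤ 100 * h → 81 * a₂ ≤ 100 * h → 81 * a₃ ≤ 100 * h → 81 * a₄ ≤ 100 * h →
                 256 * (a₁ * a₂ * a₃ * a₄) ≤ 625 * (h * h * h * h)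
  four-fifths⁴ a₁ a₂ a₃ a₄ h h₁ h₂ h₃ h₄ =
    subst₂ _≤_ (fours a₁ a₂ a₃ a₄) (fives h)
      (ℕₚ.*-mono-≤ (ℕₚ.*-mono-≤ (ℕₚ.*-mono-≤ (four-fifths a₁ h₁) (four-fifths a₂ h₂)) (four-fifths a₃ h₃)) (four-fifths a₄ h₄))
    where
    fours : ∀ a₁ a₂ a₃ a₄ → 4 * a₁ * (4 * a₂) * (4 * a₃) * (4 * a₄) ≡ 256 * (a₁ * a₂ * a₃ * a₄)
    fours = solve-∀
    fives : ∀ h → 5 * h * (5 * h) * (5 * h) * (5 * h) ≡ 625 * (h * h * h * h)
    fives = solve-∀
    four-fifths : ∀ a → 81 * a ≤ 100 * h → 4 * a ≤ 5 * h
    four-fifths a 81a≤100h = ℕₚ.*-cancelˡ-≤ 20 (begin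
      20 * (4 * a)   ≡⟨ ℕₚ.*-assoc 20 4 a ⟨
      80 * a         ≤⟨ ℕₚ.*-monoˡ-≤ a (ℕₚ.n≤1+n 80) ⟩
      81 * a         ≤⟨ 81a≤100h ⟩
      100 * h        ≡⟨ ℕₚ.*-assoc 20 5 h ⟩
      20 * (5 * h)   ∎)
      where open ℕₚ.≤-Reasoning

  [a+b]⁴≤16a⁴ : ∀ a b t → t ≤ a + b → 16 * (b * b * b * b) ≤ t * t * t * t → t * t * t * t ≤ 16 * (a * a * a * a)
  [a+b]⁴≤16a⁴ a b t t≤a+b 16b⁴≤t⁴ = subst (t * t * t * t ≤_) (sixteen a) (⁴-mono t≤2a)
    where
    sixteen : ∀ x → 2 * x * (2 * x) * (2 * x) * (2 * x) ≡ 16 * (x * x * x * x)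
    sixteen = solve-∀
    ⁴-mono : ∀ {x y} → x ≤ y → x * x * x * x ≤ y * y * y * y
    ⁴-mono x≤y = ℕₚ.*-mono-≤ (ℕₚ.*-mono-≤ (ℕₚ.*-mono-≤ x≤y x≤y) x≤y) x≤y
    2b≤t : 2 * b ≤ t
    2b≤t = ≤-of-⁴≤⁴ (subst (_≤ t * t * t * t) (sym (sixteen b)) 16b⁴≤t⁴)
    two : ∀ x → 2 * x ≡ x + x
    two = solve-∀
    b≤a : b ≤ a
    b≤a = ℕₚ.+-cancelʳ-≤ b b a (subst (_≤ a + b) (two b) (ℕₚ.≤-trans 2b≤t t≤a+b))
    t≤2a : t ≤ 2 * a
    t≤2a = ℕₚ.≤-trans t≤a+b (subst (a + b ≤_) (sym (two a)) (ℕₚ.+-monoʳ-≤ a b≤a))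

open NatArithmetic

module IntegerOrder where

  open import Data.Integer using (_+_; _*_; _≤_; 0ℤ)

  infixl 7.5 _² _⁴

  _² : ℤ → ℤ
  x ² = x * x

  _⁴ : ℤ → ℤ
  x ⁴ = x * x * x * x

  *-nonNeg : ∀ {a b} → 0ℤ ≤ a → 0ℤ ≤ b → 0ℤ ≤ a * b
  *-nonNeg {a} {b} 0≤a 0≤b = subst (_≤ a * b) (ℤₚ.*-zeroˡ b) (ℤₚ.*-monoʳ-≤-nonNeg b {{ℤ.nonNegative 0≤b}} 0≤a)

  *-monoˡ-≤-nonNeg : ∀ {c a b} → 0ℤ ≤ c → a ≤ b → c * a ≤ c * b
  *-monoˡ-≤-nonNeg {c} 0≤c = ℤₚ.*-monoˡ-≤-nonNeg c {{ℤ.nonNegative 0≤c}}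

  *-monoʳ-≤-nonNeg : ∀ {c a b} → 0ℤ ≤ c → a ≤ b → a * c ≤ b * c
  *-monoʳ-≤-nonNeg {c} 0≤c = ℤₚ.*-monoʳ-≤-nonNeg c {{ℤ.nonNegative 0≤c}}

  *-mono-≤-nonNeg : ∀ {a b c d} → 0ℤ ≤ a → 0ℤ ≤ c → a ≤ b → c ≤ d → a * c ≤ b * d
  *-mono-≤-nonNeg 0≤a 0≤c a≤b c≤d =
    ℤₚ.≤-trans (*-monoˡ-≤-nonNeg 0≤a c≤d) (*-monoʳ-≤-nonNeg (ℤₚ.≤-trans 0≤c c≤d) a≤b)

  *⁴-mono-≤-nonNeg : ∀ {a₁ a₂ a₃ a₄ b₁ b₂ b₃ b₄} → 0ℤ ≤ a₁ → 0ℤ ≤ a₂ → 0ℤ ≤ a₃ → 0ℤ ≤ a₄ →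
                     a₁ ≤ b₁ → a₂ ≤ b₂ → a₃ ≤ b₃ → a₄ ≤ b₄ → a₁ * a₂ * a₃ * a₄ ≤ b₁ * b₂ * b₃ * b₄
  *⁴-mono-≤-nonNeg 0≤a₁ 0≤a₂ 0≤a₃ 0≤a₄ a₁≤b₁ a₂≤b₂ a₃≤b₃ a₄≤b₄ =
    *-mono-≤-nonNeg (*-nonNeg (*-nonNeg 0≤a₁ 0≤a₂) 0≤a₃) 0≤a₄
      (*-mono-≤-nonNeg (*-nonNeg 0≤a₁ 0≤a₂) 0≤a₃ (*-mono-≤-nonNeg 0≤a₁ 0≤a₂ a₁≤b₁ a₂≤b₂) a₃≤b₃) a₄≤b₄

  ²-nonNeg : ∀ a → 0ℤ ≤ a ²
  ²-nonNeg (+ n)    = *-nonNeg {+ n} {+ n} (+≤+ ℕ.z≤n) (+≤+ ℕ.z≤n)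
  ²-nonNeg -[1+ n ] = +≤+ ℕ.z≤n

  ⁴-nonNeg : ∀ a → 0ℤ ≤ a ⁴
  ⁴-nonNeg a = subst (0ℤ ≤_) (sym (ℤₚ.*-assoc (a * a) a a)) (*-nonNeg (²-nonNeg a) (²-nonNeg a))

  ²-mono-≤ : ∀ {a b} → 0ℤ ≤ a → a ≤ b → a ² ≤ b ²
  ²-mono-≤ 0≤a a≤b = *-mono-≤-nonNeg 0≤a 0≤a a≤b a≤b

  ²-∣∣ : ∀ x → x ² ≡ + (ℤ.∣ x ∣ ℕ.* ℤ.∣ x ∣)
  ²-∣∣ x = trans (sym (ℤₚ.0≤i⇒+∣i∣≡i (²-nonNeg x))) (cong +_ (ℤₚ.abs-* x x))

  ≤-of-+-nonNeg : ∀ {x y u} → 0ℤ ≤ u → x + u ≡ y → x ≤ y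
  ≤-of-+-nonNeg {x} 0≤u refl = ℤₚ.i≤i+j x _ {{ℤ.nonNegative 0≤u}}

  ⁴-∣∣ : ∀ x → x ⁴ ≡ + (ℤ.∣ x ∣ ℕ.* ℤ.∣ x ∣ ℕ.* ℤ.∣ x ∣ ℕ.* ℤ.∣ x ∣)
  ⁴-∣∣ x = begin
    x ⁴                                                     ≡⟨ ℤₚ.0≤i⇒+∣i∣≡i (⁴-nonNeg x) ⟨
    + ℤ.∣ x * x * x * x ∣                                   ≡⟨ cong +_ (ℤₚ.abs-* (x * x * x) x) ⟩
    + (ℤ.∣ x * x * x ∣ ℕ.* ℤ.∣ x ∣)                          ≡⟨ cong (λ t → + (t ℕ.* ℤ.∣ x ∣)) (ℤₚ.abs-* (x * x) x) ⟩
    + (ℤ.∣ x * x ∣ ℕ.* ℤ.∣ x ∣ ℕ.* ℤ.∣ x ∣)                  ≡⟨ cong (λ t → + (t ℕ.* ℤ.∣ x ∣ ℕ.* ℤ.∣ x ∣)) (ℤₚ.abs-* x x) ⟩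
    + (ℤ.∣ x ∣ ℕ.* ℤ.∣ x ∣ ℕ.* ℤ.∣ x ∣ ℕ.* ℤ.∣ x ∣)          ∎
    where open ≡-Reasoning

  [x+y]⁴≤16x⁴ : ∀ x y → + 16 * y ⁴ ≤ (x + y) ⁴ → (x + y) ⁴ ≤ + 16 * x ⁴
  [x+y]⁴≤16x⁴ x y 16y⁴≤[x+y]⁴ = subst₂ _≤_ (sym (⁴-∣∣ (x + y))) (16*⁴-∣∣ x)
    (+≤+ ([a+b]⁴≤16a⁴ ℤ.∣ x ∣ ℤ.∣ y ∣ ℤ.∣ x + y ∣ (ℤₚ.∣i+j∣≤∣i∣+∣j∣ x y) 16∣y∣⁴≤∣x+y∣⁴))
    where
    ∣_∣⁴ : ℤ → ℕ
    ∣ z ∣⁴ = ℤ.∣ z ∣ ℕ.* ℤ.∣ z ∣ ℕ.* ℤ.∣ z ∣ ℕ.* ℤ.∣ z ∣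
    16*⁴-∣∣ : ∀ z → + (16 ℕ.* ∣ z ∣⁴) ≡ + 16 * z ⁴
    16*⁴-∣∣ z = trans (ℤₚ.pos-* 16 (∣ z ∣⁴)) (cong (+ 16 *_) (sym (⁴-∣∣ z)))
    16∣y∣⁴≤∣x+y∣⁴ : 16 ℕ.* ∣ y ∣⁴ ℕ.≤ ∣ x + y ∣⁴
    16∣y∣⁴≤∣x+y∣⁴ = ℤₚ.drop‿+≤+ (subst₂ _≤_ (sym (16*⁴-∣∣ y)) (⁴-∣∣ (x + y)) 16y⁴≤[x+y]⁴)

open IntegerOrder

module Inequalities where

  open import Data.Integer using (_+_; _*_; -_; _-_; _≤_; 0ℤ)
  open import Data.Integer.Tactic.RingSolver using (solve-∀)

  -- Opaque so that Agda's injectivity analysis of cauchy-schwarz does not normalise the ring-solver proof.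
  opaque
    cauchy-schwarz-step : ∀ a b C F G → C ² ≤ F * G → 0ℤ ≤ a ² * G + (- (+ 2 * a * b) * C + b ² * F) →
                          (a * b + C) ² ≤ (a ² + F) * (b ² + G)
    cauchy-schwarz-step a b C F G C²≤FG 0≤cross =
      ≤-of-+-nonNeg (ℤₚ.+-mono-≤ (ℤₚ.i≤j⇒0≤j-i C²≤FG) 0≤cross) (lagrange a b C F G)
      where
      lagrange : ∀ a b C F G →
        (a * b + C) * (a * b + C) + ((F * G - C * C) + (a * a * G + (- (+ 2 * a * b) * C + b * b * F)))
        ≡ (a * a + F) * (b * b + G)
      lagrange = solve-∀

  module _ {X : Set} where

    sumℤ-square-expansion : ∀ xs (f g : X → ℤ) a b →
      sumℤ xs (λ x → (a * g x - b * f x) ²)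
      ≡ a ² * sumℤ xs (λ x → g x ²) + (- (+ 2 * a * b) * sumℤ xs (λ x → f x * g x) + b ² * sumℤ xs (λ x → f x ²))
    sumℤ-square-expansion xs f g a b = begin
      sumℤ xs (λ x → (a * g x - b * f x) ²)
        ≡⟨ sumℤ-cong xs (λ x → expand (f x) (g x)) ⟩
      sumℤ xs (λ x → a ² * g x ² + (c * (f x * g x) + b ² * f x ²))
        ≡⟨ sumℤ-+ xs (λ x → a ² * g x ²) (λ x → c * (f x * g x) + b ² * f x ²) ⟩
      sumℤ xs (λ x → a ² * g x ²) + sumℤ xs (λ x → c * (f x * g x) + b ² * f x ²)
        ≡⟨ cong (_+_ (sumℤ xs (λ x → a ² * g x ²))) (sumℤ-+ xs (λ x → c * (f x * g x)) (λ x → b ² * f x ²)) ⟩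
      sumℤ xs (λ x → a ² * g x ²) + (sumℤ xs (λ x → c * (f x * g x)) + sumℤ xs (λ x → b ² * f x ²))
        ≡⟨ cong₂ _+_ (sumℤ-*ˡ xs (a ²) (λ x → g x ²))
                     (cong₂ _+_ (sumℤ-*ˡ xs c (λ x → f x * g x)) (sumℤ-*ˡ xs (b ²) (λ x → f x ²))) ⟩
      a ² * sumℤ xs (λ x → g x ²) + (c * sumℤ xs (λ x → f x * g x) + b ² * sumℤ xs (λ x → f x ²)) ∎
      where
      open ≡-Reasoning
      c = - (+ 2 * a * b)
      expand : ∀ u v → (a * v - b * u) ² ≡ a ² * v ² + (- (+ 2 * a * b) * (u * v) + b ² * u ²)
      expand u v = ring a b u v
        where
        ring : ∀ a b u v → (a * v - b * u) * (a * v - b * u)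
                           ≡ (a * a) * (v * v) + (- (+ 2 * a * b) * (u * v) + (b * b) * (u * u))
        ring = solve-∀

    cauchy-schwarz : ∀ xs (f g : X → ℤ) →
      sumℤ xs (λ x → f x * g x) ² ≤ sumℤ xs (λ x → f x ²) * sumℤ xs (λ x → g x ²)
    cauchy-schwarz []       f g = ℤₚ.≤-refl
    cauchy-schwarz (x ∷ xs) f g =
      cauchy-schwarz-step (f x) (g x) (sumℤ xs (λ y → f y * g y)) (sumℤ xs (λ y → f y ²)) (sumℤ xs (λ y → g y ²))
        (cauchy-schwarz xs f g)
        (subst (0ℤ ≤_) (sumℤ-square-expansion xs f g (f x) (g x)) (sumℤ-nonNeg xs (λ y → ²-nonNeg (f x * g y - g x * f y))))

    hölder⁴ : ∀ xs (p q r s : X → ℤ) →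
      sumℤ xs (λ x → p x * q x * r x * s x) ⁴
      ≤ sumℤ xs (λ x → p x ⁴) * sumℤ xs (λ x → q x ⁴) * sumℤ xs (λ x → r x ⁴) * sumℤ xs (λ x → s x ⁴)
    hölder⁴ xs p q r s = begin
      S (λ x → p x * q x * r x * s x) ⁴
        ≡⟨ ⁴-as-²² (S (λ x → p x * q x * r x * s x)) ⟩
      (S (λ x → p x * q x * r x * s x) ²) ²
        ≡⟨ cong (λ t → (t ²) ²) (sumℤ-cong xs (λ x → ℤₚ.*-assoc (p x * q x) (r x) (s x))) ⟩
      (S (λ x → (p x * q x) * (r x * s x)) ²) ²
        ≤⟨ ²-mono-≤ (²-nonNeg (S (λ x → (p x * q x) * (r x * s x)))) (cauchy-schwarz xs (λ x → p x * q x) (λ x → r x * s x)) ⟩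
      (S (λ x → (p x * q x) ²) * S (λ x → (r x * s x) ²)) ²
        ≡⟨ ²-distrib-* (S (λ x → (p x * q x) ²)) _ ⟩
      S (λ x → (p x * q x) ²) ² * S (λ x → (r x * s x) ²) ²
        ≤⟨ *-mono-≤-nonNeg (²-nonNeg (S (λ x → (p x * q x) ²))) (²-nonNeg (S (λ x → (r x * s x) ²)))
                           (cauchy-schwarz-² p q) (cauchy-schwarz-² r s) ⟩
      S (λ x → p x ⁴) * S (λ x → q x ⁴) * (S (λ x → r x ⁴) * S (λ x → s x ⁴))
        ≡⟨ ℤₚ.*-assoc (S (λ x → p x ⁴) * S (λ x → q x ⁴)) _ _ ⟨
      S (λ x → p x ⁴) * S (λ x → q x ⁴) * S (λ x → r x ⁴) * S (λ x → s x ⁴) ∎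
      where
      open ℤₚ.≤-Reasoning
      S = sumℤ xs
      ⁴-as-²² : ∀ t → t * t * t * t ≡ (t * t) * (t * t)
      ⁴-as-²² = solve-∀
      ²-distrib-* : ∀ u v → (u * v) * (u * v) ≡ (u * u) * (v * v)
      ²-distrib-* = solve-∀
      cauchy-schwarz-² : ∀ (u v : X → ℤ) → S (λ x → (u x * v x) ²) ² ≤ S (λ x → u x ⁴) * S (λ x → v x ⁴)
      cauchy-schwarz-² u v = subst₂ _≤_
        (cong _² (sumℤ-cong xs (λ x → ²*²≡[*]² (u x) (v x))))
        (cong₂ _*_ (sumℤ-cong xs (λ x → sym (⁴-as-²² (u x)))) (sumℤ-cong xs (λ x → sym (⁴-as-²² (v x)))))
        (cauchy-schwarz xs (λ x → u x ²) (λ x → v x ²))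
        where
        ²*²≡[*]² : ∀ s t → (s * s) * (t * t) ≡ (s * t) * (s * t)
        ²*²≡[*]² = solve-∀

    hölder⁴-𝟙 : ∀ xs (W : X → Bool) (F₁ F₂ F₃ F₄ : X → ℤ) →
      sumℤ xs (λ x → 𝟙 (W x) * (F₁ x * F₂ x * F₃ x * F₄ x)) ⁴
      ≤ sumℤ xs (λ x → 𝟙 (W x) * F₁ x ⁴) * sumℤ xs (λ x → 𝟙 (W x) * F₂ x ⁴)
        * sumℤ xs (λ x → 𝟙 (W x) * F₃ x ⁴) * sumℤ xs (λ x → 𝟙 (W x) * F₄ x ⁴)
    hölder⁴-𝟙 xs W F₁ F₂ F₃ F₄ = subst₂ _≤_
      (cong _⁴ (sumℤ-cong xs (λ x → 𝟙-*⁴ (W x) (F₁ x) (F₂ x) (F₃ x) (F₄ x))))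
      (cong₂ _*_ (cong₂ _*_ (cong₂ _*_ (restrict F₁) (restrict F₂)) (restrict F₃)) (restrict F₄))
      (hölder⁴ xs (weighted F₁) (weighted F₂) (weighted F₃) (weighted F₄))
      where
      weighted : (X → ℤ) → X → ℤ
      weighted F x = 𝟙 (W x) * F x
      𝟙-*⁴ : ∀ b a₁ a₂ a₃ a₄ → (𝟙 b * a₁) * (𝟙 b * a₂) * (𝟙 b * a₃) * (𝟙 b * a₄) ≡ 𝟙 b * (a₁ * a₂ * a₃ * a₄)
      𝟙-*⁴ false _ _ _ _ = refl
      𝟙-*⁴ true        = solve-∀
      𝟙-⁴ : ∀ b a → (𝟙 b * a) * (𝟙 b * a) * (𝟙 b * a) * (𝟙 b * a) ≡ 𝟙 b * (a * a * a * a)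
      𝟙-⁴ false _ = refl
      𝟙-⁴ true    = solve-∀
      restrict : ∀ F → sumℤ xs (λ x → weighted F x ⁴) ≡ sumℤ xs (λ x → 𝟙 (W x) * F x ⁴)
      restrict F = sumℤ-cong xs (λ x → 𝟙-⁴ (W x) (F x))

open Inequalities

module Fourier where

  open import Data.Integer using (_+_; _*_; _≤_; 0ℤ; 1ℤ)
  open CommSemigroupₚ ℤₚ.*-commutativeSemigroup using () renaming (x∙yz≈y∙xz to *-x∙yz≈y∙xz)
  open CommSemigroupₚ (CommutativeRing.+-commutativeSemigroup Boolₚ.xor-∧-commutativeRing)
    using () renaming (interchange to xor-interchange)
  open import Data.Integer.Tactic.RingSolver using (solve-∀)

  𝟙-∧ : ∀ a b → 𝟙 (a ∧ b) ≡ 𝟙 a * 𝟙 b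
  𝟙-∧ false b = refl
  𝟙-∧ true  b = sym (ℤₚ.*-identityˡ (𝟙 b))

  𝟙-idem : ∀ a → 𝟙 a * 𝟙 a ≡ 𝟙 a
  𝟙-idem false = refl
  𝟙-idem true  = refl

  𝟙-nonNeg : ∀ a → 0ℤ ≤ 𝟙 a
  𝟙-nonNeg false = +≤+ ℕ.z≤n
  𝟙-nonNeg true  = +≤+ ℕ.z≤n

  sumℤ-partition : ∀ {X : Set} xs (W : X → Bool) (f : X → ℤ) →
                   sumℤ xs f ≡ sumℤ xs (λ x → 𝟙 (W x) * f x) + sumℤ xs (λ x → 𝟙 (not (W x)) * f x)
  sumℤ-partition xs W f = trans (sumℤ-cong xs (λ x → sym (𝟙-split (W x) (f x))))
                                (sumℤ-+ xs (λ x → 𝟙 (W x) * f x) (λ x → 𝟙 (not (W x)) * f x))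
    where
    𝟙-split : ∀ b z → 𝟙 b * z + 𝟙 (not b) * z ≡ z
    𝟙-split false z = ℤₚ.+-identityˡ (𝟙 true * z) ⟨ trans ⟩ ℤₚ.*-identityˡ z
    𝟙-split true  z = ℤₚ.+-identityʳ (𝟙 true * z) ⟨ trans ⟩ ℤₚ.*-identityˡ z

  card-𝟙 : ∀ {n} (A : Subset n) → + card A ≡ ∑[ x ] 𝟙 (A x)
  card-𝟙 {n} A = +-sumℕ (allVecs n) (b2n ∘ A)

  fourierSum-χ : ∀ {n} (A : Subset n) ξ → fourierSum A ξ ≡ ∑[ x ] 𝟙 (A x) * χ ξ x
  fourierSum-χ {n} A ξ = sumℤ-cong (allVecs n) (λ x → if-𝟙 (A x) (χ ξ x))
    where
    if-𝟙 : ∀ b z → (if b then z else 0ℤ) ≡ 𝟙 b * z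
    if-𝟙 false z = refl
    if-𝟙 true  z = sym (ℤₚ.*-identityˡ z)

  fourierSum-𝟎 : ∀ {n} (A : Subset n) → fourierSum A 𝟎 ≡ + card A
  fourierSum-𝟎 {n} A = begin
    fourierSum A 𝟎              ≡⟨ fourierSum-χ A 𝟎 ⟩
    ∑[ x ] 𝟙 (A x) * χ 𝟎 x      ≡⟨ sumℤ-cong (allVecs n) (λ x → cong (𝟙 (A x) *_) (trans (χ-comm 𝟎 x) (χ-zeroʳ x))) ⟩
    ∑[ x ] 𝟙 (A x) * 1ℤ         ≡⟨ sumℤ-cong (allVecs n) (λ x → ℤₚ.*-identityʳ (𝟙 (A x))) ⟩
    ∑[ x ] 𝟙 (A x)              ≡⟨ card-𝟙 A ⟨
    + card A                     ∎
    where open ≡-Reasoning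

  ∑-weighted-fourierSum² : ∀ {n} (A : Subset n) (w : 𝔽₂^ n → ℤ) →
    ∑[ ξ ] w ξ * fourierSum A ξ ² ≡ ∑[ x ] ∑[ y ] 𝟙 (A x) * 𝟙 (A y) * (∑[ ξ ] w ξ * χ ξ (y ⊕ x))
  ∑-weighted-fourierSum² {n} A w = begin
    ∑[ ξ ] w ξ * fourierSum A ξ ²
      ≡⟨ sumℤ-cong L (λ ξ → cong (w ξ *_) (trans (cong₂ _*_ (fourierSum-χ A ξ) (fourierSum-χ A ξ))
                                                  (sumℤ-*-sumℤ L L (f ξ) (f ξ)))) ⟩
    ∑[ ξ ] w ξ * (∑[ x ] ∑[ y ] f ξ x * f ξ y)
      ≡⟨ sumℤ-cong L (λ ξ → trans (sym (sumℤ-*ˡ L (w ξ) (λ x → ∑[ y ] f ξ x * f ξ y)))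
                                  (sumℤ-cong L (λ x → sym (sumℤ-*ˡ L (w ξ) (λ y → f ξ x * f ξ y))))) ⟩
    ∑[ ξ ] ∑[ x ] ∑[ y ] w ξ * (f ξ x * f ξ y)
      ≡⟨ trans (sumℤ-swap L L (λ ξ x → ∑[ y ] w ξ * (f ξ x * f ξ y)))
               (sumℤ-cong L (λ x → sumℤ-swap L L (λ ξ y → w ξ * (f ξ x * f ξ y)))) ⟩
    ∑[ x ] ∑[ y ] ∑[ ξ ] w ξ * (f ξ x * f ξ y)
      ≡⟨ sumℤ-cong L (λ x → sumℤ-cong L (λ y →
           trans (sumℤ-cong L (regroup x y)) (sumℤ-*ˡ L (𝟙 (A x) * 𝟙 (A y)) _))) ⟩
    ∑[ x ] ∑[ y ] 𝟙 (A x) * 𝟙 (A y) * (∑[ ξ ] w ξ * χ ξ (y ⊕ x)) ∎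
    where
    open ≡-Reasoning
    L = allVecs n
    f : 𝔽₂^ n → 𝔽₂^ n → ℤ
    f ξ x = 𝟙 (A x) * χ ξ x
    regroup : ∀ x y ξ → w ξ * (f ξ x * f ξ y) ≡ 𝟙 (A x) * 𝟙 (A y) * (w ξ * χ ξ (y ⊕ x))
    regroup x y ξ = trans (ring (w ξ) (𝟙 (A x)) (χ ξ x) (𝟙 (A y)) (χ ξ y))
                          (cong (λ t → 𝟙 (A x) * 𝟙 (A y) * (w ξ * t)) (sym (χ-⊕ʳ ξ y x)))
      where
      ring : ∀ w a s b t → w * ((a * s) * (b * t)) ≡ a * b * (w * (t * s))
      ring = solve-∀

  ∑-indicator-translate : ∀ {n} (g : 𝔽₂^ n → ℤ) x → ∑[ y ] g y * 𝟙 (eqBits (y ⊕ x) 𝟎) ≡ g x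
  ∑-indicator-translate {n} g x = begin
    ∑[ y ] g y * 𝟙 (eqBits (y ⊕ x) 𝟎)                 ≡⟨ ∑-translate x (λ y → g y * 𝟙 (eqBits (y ⊕ x) 𝟎)) ⟨
    ∑[ y ] g (y ⊕ x) * 𝟙 (eqBits ((y ⊕ x) ⊕ x) 𝟎)     ≡⟨ sumℤ-cong (allVecs n) (λ y →
                                                           trans (ℤₚ.*-comm (g (y ⊕ x)) _)
                                                                 (cong (λ z → 𝟙 (eqBits z 𝟎) * g (y ⊕ x)) (⊕-cancelʳ y x))) ⟩
    ∑[ y ] 𝟙 (eqBits y 𝟎) * g (y ⊕ x)                 ≡⟨ ∑-indicator-𝟎 (λ y → g (y ⊕ x)) ⟩
    g (𝟎 ⊕ x)                                          ≡⟨ cong g (⊕-identityˡ x) ⟩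
    g x                                                ∎
    where open ≡-Reasoning

  parseval : ∀ {n} (A : Subset n) → ∑[ ξ ] fourierSum A ξ ² ≡ 2^ n * + card A
  parseval {n} A = begin
    ∑[ ξ ] fourierSum A ξ ²
      ≡⟨ sumℤ-cong L (λ ξ → ℤₚ.*-identityˡ (fourierSum A ξ ²)) ⟨
    ∑[ ξ ] 1ℤ * fourierSum A ξ ²
      ≡⟨ ∑-weighted-fourierSum² A (λ _ → 1ℤ) ⟩
    ∑[ x ] ∑[ y ] 𝟙 (A x) * 𝟙 (A y) * (∑[ ξ ] 1ℤ * χ ξ (y ⊕ x))
      ≡⟨ sumℤ-cong L (λ x → sumℤ-cong L (λ y →
           trans (cong (𝟙 (A x) * 𝟙 (A y) *_) (trans (sumℤ-cong L (λ ξ → ℤₚ.*-identityˡ (χ ξ (y ⊕ x)))) (∑-χ (y ⊕ x))))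
                 (ring (𝟙 (A x)) (𝟙 (A y)) (2^ n) _))) ⟩
    ∑[ x ] ∑[ y ] 2^ n * 𝟙 (A x) * (𝟙 (A y) * 𝟙 (eqBits (y ⊕ x) 𝟎))
      ≡⟨ sumℤ-cong L (λ x → trans (sumℤ-*ˡ L (2^ n * 𝟙 (A x)) _)
                                  (cong (2^ n * 𝟙 (A x) *_) (∑-indicator-translate (𝟙 ∘ A) x))) ⟩
    ∑[ x ] 2^ n * 𝟙 (A x) * 𝟙 (A x)
      ≡⟨ sumℤ-cong L (λ x → trans (ℤₚ.*-assoc (2^ n) _ _) (cong (2^ n *_) (𝟙-idem (A x)))) ⟩
    ∑[ x ] 2^ n * 𝟙 (A x)
      ≡⟨ trans (sumℤ-*ˡ L (2^ n) (𝟙 ∘ A)) (cong (2^ n *_) (sym (card-𝟙 A))) ⟩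
    2^ n * + card A ∎
    where
    open ≡-Reasoning
    L = allVecs n
    ring : ∀ a b N e → a * b * (N * e) ≡ N * a * (b * e)
    ring = solve-∀

  energy-fourierSum : ∀ {n} (A₁ A₂ A₃ A₄ : Subset n) →
    2^ n * + energyCount A₁ A₂ A₃ A₄
    ≡ ∑[ ξ ] fourierSum A₁ ξ * fourierSum A₂ ξ * fourierSum A₃ ξ * fourierSum A₄ ξ
  energy-fourierSum {n} A₁ A₂ A₃ A₄ = sym (begin
    ∑[ ξ ] fourierSum A₁ ξ * fourierSum A₂ ξ * fourierSum A₃ ξ * fourierSum A₄ ξ
      ≡⟨ sumℤ-cong L (λ ξ → trans (cong₂ _*_ (cong₂ _*_ (cong₂ _*_ (fourierSum-χ A₁ ξ) (fourierSum-χ A₂ ξ))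
                                                         (fourierSum-χ A₃ ξ)) (fourierSum-χ A₄ ξ))
                                  (sumℤ-*⁴ L (f A₁ ξ) (f A₂ ξ) (f A₃ ξ) (f A₄ ξ))) ⟩
    ∑[ ξ ] ∑[ a ] ∑[ b ] ∑[ c ] ∑[ d ] T ξ a b c d
      ≡⟨ sumℤ-swap L L (λ ξ a → ∑[ b ] ∑[ c ] ∑[ d ] T ξ a b c d) ⟩
    ∑[ a ] ∑[ ξ ] ∑[ b ] ∑[ c ] ∑[ d ] T ξ a b c d
      ≡⟨ sumℤ-cong L (λ a → sumℤ-swap L L (λ ξ b → ∑[ c ] ∑[ d ] T ξ a b c d)) ⟩
    ∑[ a ] ∑[ b ] ∑[ ξ ] ∑[ c ] ∑[ d ] T ξ a b c d
      ≡⟨ sumℤ-cong L (λ a → sumℤ-cong L (λ b → sumℤ-swap L L (λ ξ c → ∑[ d ] T ξ a b c d))) ⟩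
    ∑[ a ] ∑[ b ] ∑[ c ] ∑[ ξ ] ∑[ d ] T ξ a b c d
      ≡⟨ ∑³-cong (λ a b c → sumℤ-swap L L (λ ξ d → T ξ a b c d)) ⟩
    ∑[ a ] ∑[ b ] ∑[ c ] ∑[ d ] ∑[ ξ ] T ξ a b c d
      ≡⟨ ∑³-cong (λ a b c → sumℤ-cong L (λ d → ∑-T a b c d)) ⟩
    ∑[ a ] ∑[ b ] ∑[ c ] ∑[ d ] 2^ n * I a b c d
      ≡⟨ ∑³-cong (λ a b c → sumℤ-*ˡ L (2^ n) (I a b c)) ⟩
    ∑[ a ] ∑[ b ] ∑[ c ] 2^ n * (∑[ d ] I a b c d)
      ≡⟨ sumℤ-cong L (λ a → sumℤ-cong L (λ b → sumℤ-*ˡ L (2^ n) (λ c → ∑[ d ] I a b c d))) ⟩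
    ∑[ a ] ∑[ b ] 2^ n * (∑[ c ] ∑[ d ] I a b c d)
      ≡⟨ sumℤ-cong L (λ a → sumℤ-*ˡ L (2^ n) (λ b → ∑[ c ] ∑[ d ] I a b c d)) ⟩
    ∑[ a ] 2^ n * (∑[ b ] ∑[ c ] ∑[ d ] I a b c d)
      ≡⟨ sumℤ-*ˡ L (2^ n) (λ a → ∑[ b ] ∑[ c ] ∑[ d ] I a b c d) ⟩
    2^ n * (∑[ a ] ∑[ b ] ∑[ c ] ∑[ d ] I a b c d)
      ≡⟨ cong (2^ n *_) count ⟨
    2^ n * + energyCount A₁ A₂ A₃ A₄ ∎)
    where
    open ≡-Reasoning
    L = allVecs n
    f : Subset n → 𝔽₂^ n → 𝔽₂^ n → ℤ
    f A ξ x = 𝟙 (A x) * χ ξ x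
    T : 𝔽₂^ n → 𝔽₂^ n → 𝔽₂^ n → 𝔽₂^ n → 𝔽₂^ n → ℤ
    T ξ a b c d = f A₁ ξ a * f A₂ ξ b * f A₃ ξ c * f A₄ ξ d
    J : 𝔽₂^ n → 𝔽₂^ n → 𝔽₂^ n → 𝔽₂^ n → ℤ
    J a b c d = 𝟙 (A₁ a) * (𝟙 (A₂ b) * (𝟙 (A₃ c) * 𝟙 (A₄ d)))
    I : 𝔽₂^ n → 𝔽₂^ n → 𝔽₂^ n → 𝔽₂^ n → ℤ
    I a b c d = 𝟙 (A₁ a ∧ A₂ b ∧ A₃ c ∧ A₄ d ∧ eqBits (a ⊕ (b ⊕ (c ⊕ d))) 𝟎)
    ∑³-cong : {P Q : 𝔽₂^ n → 𝔽₂^ n → 𝔽₂^ n → ℤ} → (∀ a b c → P a b c ≡ Q a b c) →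
              ∑[ a ] ∑[ b ] ∑[ c ] P a b c ≡ ∑[ a ] ∑[ b ] ∑[ c ] Q a b c
    ∑³-cong P≡Q = sumℤ-cong L (λ a → sumℤ-cong L (λ b → sumℤ-cong L (P≡Q a b)))
    count : + energyCount A₁ A₂ A₃ A₄ ≡ ∑[ a ] ∑[ b ] ∑[ c ] ∑[ d ] I a b c d
    count = trans (+-sumℕ L _) (sumℤ-cong L λ a → trans (+-sumℕ L _) (sumℤ-cong L λ b →
              trans (+-sumℕ L _) (sumℤ-cong L λ c → +-sumℕ L _)))
    χ-⊕⁴ : ∀ ξ a b c d → χ ξ a * χ ξ b * χ ξ c * χ ξ d ≡ χ ξ (a ⊕ (b ⊕ (c ⊕ d)))
    χ-⊕⁴ ξ a b c d = begin
      χ ξ a * χ ξ b * χ ξ c * χ ξ d         ≡⟨ ring (χ ξ a) (χ ξ b) (χ ξ c) (χ ξ d) ⟩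
      χ ξ a * (χ ξ b * (χ ξ c * χ ξ d))     ≡⟨ cong (λ t → χ ξ a * (χ ξ b * t)) (χ-⊕ʳ ξ c d) ⟨
      χ ξ a * (χ ξ b * χ ξ (c ⊕ d))         ≡⟨ cong (χ ξ a *_) (χ-⊕ʳ ξ b (c ⊕ d)) ⟨
      χ ξ a * χ ξ (b ⊕ (c ⊕ d))             ≡⟨ χ-⊕ʳ ξ a (b ⊕ (c ⊕ d)) ⟨
      χ ξ (a ⊕ (b ⊕ (c ⊕ d)))               ∎
      where
      ring : ∀ p q r s → p * q * r * s ≡ p * (q * (r * s))
      ring = solve-∀
    J-𝟙 : ∀ a b c d → J a b c d * 𝟙 (eqBits (a ⊕ (b ⊕ (c ⊕ d))) 𝟎) ≡ I a b c d
    J-𝟙 a b c d = begin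
      J a b c d * e                                          ≡⟨ ring (𝟙 (A₁ a)) (𝟙 (A₂ b)) (𝟙 (A₃ c)) (𝟙 (A₄ d)) e ⟩
      𝟙 (A₁ a) * (𝟙 (A₂ b) * (𝟙 (A₃ c) * (𝟙 (A₄ d) * e)))     ≡⟨ cong (λ t → 𝟙 (A₁ a) * (𝟙 (A₂ b) * (𝟙 (A₃ c) * t)))
                                                                    (𝟙-∧ (A₄ d) _) ⟨
      𝟙 (A₁ a) * (𝟙 (A₂ b) * (𝟙 (A₃ c) * 𝟙 (A₄ d ∧ _)))       ≡⟨ cong (λ t → 𝟙 (A₁ a) * (𝟙 (A₂ b) * t)) (𝟙-∧ (A₃ c) _) ⟨
      𝟙 (A₁ a) * (𝟙 (A₂ b) * 𝟙 (A₃ c ∧ _))                    ≡⟨ cong (𝟙 (A₁ a) *_) (𝟙-∧ (A₂ b) _) ⟨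
      𝟙 (A₁ a) * 𝟙 (A₂ b ∧ _)                                 ≡⟨ 𝟙-∧ (A₁ a) _ ⟨
      I a b c d                                              ∎
      where
      e = 𝟙 (eqBits (a ⊕ (b ⊕ (c ⊕ d))) 𝟎)
      ring : ∀ p q r s t → p * (q * (r * s)) * t ≡ p * (q * (r * (s * t)))
      ring = solve-∀
    ∑-T : ∀ a b c d → ∑[ ξ ] T ξ a b c d ≡ 2^ n * I a b c d
    ∑-T a b c d = begin
      ∑[ ξ ] T ξ a b c d                                 ≡⟨ sumℤ-cong L (λ ξ → trans (ring ξ) (cong (J a b c d *_) (χ-⊕⁴ ξ a b c d))) ⟩
      ∑[ ξ ] J a b c d * χ ξ (a ⊕ (b ⊕ (c ⊕ d)))         ≡⟨ sumℤ-*ˡ L (J a b c d) (λ ξ → χ ξ (a ⊕ (b ⊕ (c ⊕ d)))) ⟩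
      J a b c d * (∑[ ξ ] χ ξ (a ⊕ (b ⊕ (c ⊕ d))))       ≡⟨ cong (J a b c d *_) (∑-χ (a ⊕ (b ⊕ (c ⊕ d)))) ⟩
      J a b c d * (2^ n * 𝟙 (eqBits (a ⊕ (b ⊕ (c ⊕ d))) 𝟎)) ≡⟨ *-x∙yz≈y∙xz (J a b c d) (2^ n) _ ⟩
      2^ n * (J a b c d * 𝟙 (eqBits (a ⊕ (b ⊕ (c ⊕ d))) 𝟎)) ≡⟨ cong (2^ n *_) (J-𝟙 a b c d) ⟩
      2^ n * I a b c d                                   ∎
      where
      ring : ∀ ξ → T ξ a b c d ≡ J a b c d * (χ ξ a * χ ξ b * χ ξ c * χ ξ d)
      ring ξ = r (𝟙 (A₁ a)) (𝟙 (A₂ b)) (𝟙 (A₃ c)) (𝟙 (A₄ d)) (χ ξ a) (χ ξ b) (χ ξ c) (χ ξ d)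
        where
        r : ∀ p q r s x y z w → p * x * (q * y) * (r * z) * (s * w) ≡ p * (q * (r * s)) * (x * y * z * w)
        r = solve-∀

  sign-*-fourierSum : ∀ {n} (A : Subset n) e ξ → sign e * fourierSum A ξ ≡ ∑[ x ] 𝟙 (A x) * sign (e xor dot ξ x)
  sign-*-fourierSum {n} A e ξ = begin
    sign e * fourierSum A ξ                 ≡⟨ cong (sign e *_) (fourierSum-χ A ξ) ⟩
    sign e * (∑[ x ] 𝟙 (A x) * χ ξ x)       ≡⟨ sumℤ-*ˡ (allVecs n) (sign e) (λ x → 𝟙 (A x) * χ ξ x) ⟨
    ∑[ x ] sign e * (𝟙 (A x) * χ ξ x)       ≡⟨ sumℤ-cong (allVecs n) (λ x → trans (*-x∙yz≈y∙xz (sign e) (𝟙 (A x)) (χ ξ x))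
                                                  (cong (𝟙 (A x) *_) (sym (sign-xor e (dot ξ x))))) ⟩
    ∑[ x ] 𝟙 (A x) * sign (e xor dot ξ x)   ∎
    where open ≡-Reasoning

  ∣fourierSum∣≤card : ∀ {n} (A : Subset n) ξ → ℤ.∣ fourierSum A ξ ∣ ℕ.≤ card A
  ∣fourierSum∣≤card {n} A ξ with sign-*-∣∣ (fourierSum A ξ)
  ... | e , e*F≡∣F∣ = ℤₚ.drop‿+≤+ (begin
    + ℤ.∣ fourierSum A ξ ∣                  ≡⟨ e*F≡∣F∣ ⟨
    sign e * fourierSum A ξ                 ≡⟨ sign-*-fourierSum A e ξ ⟩
    ∑[ x ] 𝟙 (A x) * sign (e xor dot ξ x)   ≤⟨ sumℤ-mono-≤ (allVecs n) (λ x → 𝟙-*-sign≤𝟙 (A x) (e xor dot ξ x)) ⟩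
    ∑[ x ] 𝟙 (A x)                          ≡⟨ card-𝟙 A ⟨
    + card A                                ∎)
    where
    open ℤₚ.≤-Reasoning
    𝟙-*-sign≤𝟙 : ∀ a b → 𝟙 a * sign b ≤ 𝟙 a
    𝟙-*-sign≤𝟙 false b     = ℤₚ.≤-refl
    𝟙-*-sign≤𝟙 true  false = ℤₚ.≤-refl
    𝟙-*-sign≤𝟙 true  true  = -≤+

  fourierSum²≤card² : ∀ {n} (A : Subset n) ξ → fourierSum A ξ ² ≤ (+ card A) ²
  fourierSum²≤card² A ξ = begin
    fourierSum A ξ ²                   ≡⟨ ²-∣∣ (fourierSum A ξ) ⟩
    + (∣F∣ ℕ.* ∣F∣)                    ≤⟨ +≤+ (ℕₚ.*-mono-≤ (∣fourierSum∣≤card A ξ) (∣fourierSum∣≤card A ξ)) ⟩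
    + (card A ℕ.* card A)              ≡⟨ ℤₚ.pos-* (card A) (card A) ⟩
    (+ card A) ²                       ∎
    where
    open ℤₚ.≤-Reasoning
    ∣F∣ = ℤ.∣ fourierSum A ξ ∣

  fourierSum-sign-≤ : ∀ {n} (A : Subset n) ξ η e e' →
    sign e * fourierSum A ξ + sign e' * fourierSum A η ≤ + card A + sign (e xor e') * fourierSum A (ξ ⊕ η)
  fourierSum-sign-≤ {n} A ξ η e e' = begin
    sign e * fourierSum A ξ + sign e' * fourierSum A η
      ≡⟨ cong₂ _+_ (sign-*-fourierSum A e ξ) (sign-*-fourierSum A e' η) ⟩
    (∑[ x ] 𝟙 (A x) * sign (p x)) + (∑[ x ] 𝟙 (A x) * sign (q x))
      ≡⟨ sumℤ-+ L (λ x → 𝟙 (A x) * sign (p x)) (λ x → 𝟙 (A x) * sign (q x)) ⟨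
    ∑[ x ] (𝟙 (A x) * sign (p x) + 𝟙 (A x) * sign (q x))
      ≤⟨ sumℤ-mono-≤ L (λ x → pointwise (A x) (p x) (q x)) ⟩
    ∑[ x ] (𝟙 (A x) + 𝟙 (A x) * sign (p x xor q x))
      ≡⟨ sumℤ-+ L (𝟙 ∘ A) (λ x → 𝟙 (A x) * sign (p x xor q x)) ⟩
    (∑[ x ] 𝟙 (A x)) + (∑[ x ] 𝟙 (A x) * sign (p x xor q x))
      ≡⟨ cong₂ _+_ (card-𝟙 A) (sumℤ-cong L (λ x → cong (λ b → 𝟙 (A x) * sign b) (regroup x))) ⟨
    + card A + (∑[ x ] 𝟙 (A x) * sign ((e xor e') xor dot (ξ ⊕ η) x))
      ≡⟨ cong (_+_ (+ card A)) (sign-*-fourierSum A (e xor e') (ξ ⊕ η)) ⟨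
    + card A + sign (e xor e') * fourierSum A (ξ ⊕ η) ∎
    where
    open ℤₚ.≤-Reasoning
    L = allVecs n
    p q : 𝔽₂^ n → Bool
    p x = e xor dot ξ x
    q x = e' xor dot η x
    regroup : ∀ x → (e xor e') xor dot (ξ ⊕ η) x ≡ p x xor q x
    regroup x = trans (cong ((e xor e') xor_) (dot-distribˡ-⊕ ξ η x)) (xor-interchange e e' (dot ξ x) (dot η x))
    pointwise : ∀ a b c → 𝟙 a * sign b + 𝟙 a * sign c ≤ 𝟙 a + 𝟙 a * sign (b xor c)
    pointwise false b     c     = ℤₚ.≤-refl
    pointwise true  false c     = ℤₚ.≤-refl
    pointwise true  true  false = ℤₚ.≤-refl
    pointwise true  true  true  = -≤+

  ∣fourierSum∣-triangle : ∀ {n} (A : Subset n) ξ η →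
    ℤ.∣ fourierSum A ξ ∣ ℕ.+ ℤ.∣ fourierSum A η ∣ ℕ.≤ card A ℕ.+ ℤ.∣ fourierSum A (ξ ⊕ η) ∣
  ∣fourierSum∣-triangle A ξ η with sign-*-∣∣ (fourierSum A ξ) | sign-*-∣∣ (fourierSum A η)
  ... | e , e*F≡∣F∣ | e' , e'*F≡∣F∣ = ℤₚ.drop‿+≤+ (begin
    + (ℤ.∣ fourierSum A ξ ∣ ℕ.+ ℤ.∣ fourierSum A η ∣)
      ≡⟨ ℤₚ.pos-+ (ℤ.∣ fourierSum A ξ ∣) _ ⟩
    + ℤ.∣ fourierSum A ξ ∣ + + ℤ.∣ fourierSum A η ∣
      ≡⟨ cong₂ _+_ e*F≡∣F∣ e'*F≡∣F∣ ⟨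
    sign e * fourierSum A ξ + sign e' * fourierSum A η
      ≤⟨ fourierSum-sign-≤ A ξ η e e' ⟩
    + card A + sign (e xor e') * fourierSum A (ξ ⊕ η)
      ≤⟨ ℤₚ.+-monoʳ-≤ (+ card A) (sign-*-≤-∣∣ (e xor e') (fourierSum A (ξ ⊕ η))) ⟩
    + card A + + ℤ.∣ fourierSum A (ξ ⊕ η) ∣
      ≡⟨ ℤₚ.pos-+ (card A) _ ⟨
    + (card A ℕ.+ ℤ.∣ fourierSum A (ξ ⊕ η) ∣) ∎)
    where open ℤₚ.≤-Reasoning

open Fourier

module Cosets where

  open import Data.Integer using (_*_; _≤_)

  card-interCoset-𝟙 : ∀ {n} (A : Subset n) x H → + card (interCoset A x H) ≡ ∑[ y ] 𝟙 (A y) * 𝟙 (H (y ⊕ x))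
  card-interCoset-𝟙 {n} A x H = trans (card-𝟙 (interCoset A x H)) (sumℤ-cong (allVecs n) (λ y → 𝟙-∧ (A y) (H (y ⊕ x))))

  card-interCoset≤card : ∀ {n} (A : Subset n) x H → card (interCoset A x H) ℕ.≤ card H
  card-interCoset≤card {n} A x H = ℤₚ.drop‿+≤+ (begin
    + card (interCoset A x H)            ≡⟨ card-interCoset-𝟙 A x H ⟩
    ∑[ y ] 𝟙 (A y) * 𝟙 (H (y ⊕ x))       ≤⟨ sumℤ-mono-≤ (allVecs n) (λ y → 𝟙-*-≤ (A y) (H (y ⊕ x))) ⟩
    ∑[ y ] 𝟙 (H (y ⊕ x))                 ≡⟨ ∑-translate x (𝟙 ∘ H) ⟩
    ∑[ y ] 𝟙 (H y)                       ≡⟨ card-𝟙 H ⟨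
    + card H                             ∎)
    where
    open ℤₚ.≤-Reasoning
    𝟙-*-≤ : ∀ a b → 𝟙 a * 𝟙 b ≤ 𝟙 b
    𝟙-*-≤ false b = 𝟙-nonNeg b
    𝟙-*-≤ true  b = ℤₚ.≤-reflexive (ℤₚ.*-identityˡ (𝟙 b))

open Cosets

module Annihilator {n} (V : Subset n) (V-subspace : IsSubspace V) where

  open import Data.Integer using (_+_; _*_; -_; _≤_; 0ℤ; 1ℤ; -1ℤ)
  open import Data.Bool using (T)
  open import Data.Bool.ListAction using (all)
  open import Data.List.Relation.Unary.All as All using (All)
  open import Data.List.Relation.Unary.All.Properties using (all⁺; all⁻; ¬All⇒Any¬)
  open import Data.List.Relation.Unary.Any using (satisfied)
  open import Relation.Nullary.Decidable using (T?)
  open import Function.Bundles using (Equivalence)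
  open IsSubspace V-subspace
  open CommSemigroupₚ ℤₚ.*-commutativeSemigroup using (x∙yz≈z∙yx) renaming (x∙yz≈y∙xz to *-x∙yz≈y∙xz)
  open import Data.Integer.Tactic.RingSolver using (solve-∀)

  V⊥ : Subset n
  V⊥ z = all (λ ξ → not (V ξ ∧ dot ξ z)) (allVecs n)

  V⊥-orthogonal : ∀ {z ξ} → V⊥ z ≡ true → V ξ ≡ true → dot ξ z ≡ false
  V⊥-orthogonal {z} {ξ} z∈V⊥ ξ∈V = Equivalence.to Boolₚ.T-not-≡
    (subst (λ b → T (not (b ∧ dot ξ z))) ξ∈V
      (All.lookup (all⁺ _ (allVecs n) (Equivalence.from Boolₚ.T-≡ z∈V⊥)) (∈-allVecs ξ)))

  V⊥-intro : ∀ {z} → (∀ {ξ} → V ξ ≡ true → dot ξ z ≡ false) → V⊥ z ≡ true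
  V⊥-intro {z} ⊥z = Equivalence.to Boolₚ.T-≡ (all⁻ _ (All.universal orthogonal (allVecs n)))
    where
    orthogonal : ∀ ξ → T (not (V ξ ∧ dot ξ z))
    orthogonal ξ with V ξ in ξ∈V
    ... | false = _
    ... | true  = Equivalence.from Boolₚ.T-not-≡ (⊥z ξ∈V)

  V⊥-witness : ∀ {z} → V⊥ z ≡ false → ∃ λ ξ → V ξ ≡ true × dot ξ z ≡ true
  V⊥-witness {z} z∉V⊥ with satisfied (¬All⇒Any¬ (λ ξ → T? (not (V ξ ∧ dot ξ z))) (allVecs n) not-all)
    where
    not-all : ¬ All (λ ξ → T (not (V ξ ∧ dot ξ z))) (allVecs n)
    not-all all-orthogonal = subst T z∉V⊥ (all⁻ _ all-orthogonal)
  ... | ξ , ¬orthogonal = ξ , both-true (V ξ) (dot ξ z) ¬orthogonal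
    where
    both-true : ∀ a b → ¬ T (not (a ∧ b)) → a ≡ true × b ≡ true
    both-true false b     ¬t = ⊥-elim (¬t _)
    both-true true  false ¬t = ⊥-elim (¬t _)
    both-true true  true  ¬t = refl , refl

  V⊥-isSubspace : IsSubspace V⊥
  V⊥-isSubspace = record
    { zero-mem = V⊥-intro (λ {ξ} _ → dot-zeroʳ ξ)
    ; add-mem  = λ x y x∈V⊥ y∈V⊥ → V⊥-intro (λ {ξ} ξ∈V →
        trans (dot-distribʳ-⊕ ξ x y) (cong₂ _xor_ (V⊥-orthogonal x∈V⊥ ξ∈V) (V⊥-orthogonal y∈V⊥ ξ∈V)))
    }

  V-translate : ∀ {ξ₀} → V ξ₀ ≡ true → ∀ ξ → V (ξ ⊕ ξ₀) ≡ V ξ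
  V-translate {ξ₀} ξ₀∈V ξ with V ξ in ξ∈V | V (ξ ⊕ ξ₀) in ξ+ξ₀∈V
  ... | true  | _     = trans (sym ξ+ξ₀∈V) (add-mem ξ ξ₀ ξ∈V ξ₀∈V)
  ... | false | false = refl
  ... | false | true  = ⊥-elim (false≢true (trans (sym ξ∈V) (subst (λ ζ → V ζ ≡ true) (⊕-cancelʳ ξ ξ₀) (add-mem _ ξ₀ ξ+ξ₀∈V ξ₀∈V))))
    where
    false≢true : false ≢ true
    false≢true ()

  ∑-V-χ : ∀ z → ∑[ ξ ] 𝟙 (V ξ) * χ ξ z ≡ + card V * 𝟙 (V⊥ z)
  ∑-V-χ z with V⊥ z in z∈V⊥
  ... | true  = begin
    ∑[ ξ ] 𝟙 (V ξ) * χ ξ z     ≡⟨ sumℤ-cong (allVecs n) character-trivial ⟩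
    ∑[ ξ ] 𝟙 (V ξ)             ≡⟨ card-𝟙 V ⟨
    + card V                   ≡⟨ ℤₚ.*-identityʳ (+ card V) ⟨
    + card V * 𝟙 true          ∎
    where
    open ≡-Reasoning
    character-trivial : ∀ ξ → 𝟙 (V ξ) * χ ξ z ≡ 𝟙 (V ξ)
    character-trivial ξ with V ξ in ξ∈V
    ... | false = refl
    ... | true  = cong (λ b → 1ℤ * sign b) (V⊥-orthogonal z∈V⊥ ξ∈V)
  ... | false with V⊥-witness z∈V⊥
  ...   | ξ₀ , ξ₀∈V , ξ₀·z≡1 = trans (self-negating S S≡-S) (sym (ℤₚ.*-zeroʳ (+ card V)))
    where
    S = ∑[ ξ ] 𝟙 (V ξ) * χ ξ z
    flip-sign : ∀ ξ → 𝟙 (V (ξ ⊕ ξ₀)) * χ (ξ ⊕ ξ₀) z ≡ - (𝟙 (V ξ) * χ ξ z)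
    flip-sign ξ = begin
      𝟙 (V (ξ ⊕ ξ₀)) * χ (ξ ⊕ ξ₀) z     ≡⟨ cong₂ (λ v c → 𝟙 v * c) (V-translate ξ₀∈V ξ) (χ-⊕ˡ ξ ξ₀ z) ⟩
      𝟙 (V ξ) * (χ ξ z * χ ξ₀ z)        ≡⟨ cong (λ b → 𝟙 (V ξ) * (χ ξ z * sign b)) ξ₀·z≡1 ⟩
      𝟙 (V ξ) * (χ ξ z * -1ℤ)           ≡⟨ ℤₚ.*-assoc (𝟙 (V ξ)) (χ ξ z) -1ℤ ⟨
      𝟙 (V ξ) * χ ξ z * -1ℤ             ≡⟨ ℤₚ.*-comm _ -1ℤ ⟩
      -1ℤ * (𝟙 (V ξ) * χ ξ z)           ≡⟨ ℤₚ.-1*i≡-i _ ⟩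
      - (𝟙 (V ξ) * χ ξ z)               ∎
      where open ≡-Reasoning
    S≡-S : S ≡ - S
    S≡-S = begin
      S                                     ≡⟨ ∑-translate ξ₀ (λ ξ → 𝟙 (V ξ) * χ ξ z) ⟨
      ∑[ ξ ] 𝟙 (V (ξ ⊕ ξ₀)) * χ (ξ ⊕ ξ₀) z   ≡⟨ sumℤ-cong (allVecs n) flip-sign ⟩
      ∑[ ξ ] - (𝟙 (V ξ) * χ ξ z)            ≡⟨ sumℤ-neg (allVecs n) (λ ξ → 𝟙 (V ξ) * χ ξ z) ⟩
      - S                                   ∎
      where open ≡-Reasoning
    self-negating : ∀ s → s ≡ - s → s ≡ 0ℤ
    self-negating (+ zero) _  = refl
    self-negating (+ suc _) ()
    self-negating -[1+ _ ] ()

  card-V*card-V⊥ : card V ℕ.* card V⊥ ≡ 2 ℕ.^ n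
  card-V*card-V⊥ = ℤₚ.+-injective (begin
    + (card V ℕ.* card V⊥)                     ≡⟨ ℤₚ.pos-* (card V) (card V⊥) ⟩
    + card V * + card V⊥                       ≡⟨ cong (+ card V *_) (card-𝟙 V⊥) ⟩
    + card V * (∑[ z ] 𝟙 (V⊥ z))               ≡⟨ sumℤ-*ˡ L (+ card V) (𝟙 ∘ V⊥) ⟨
    ∑[ z ] + card V * 𝟙 (V⊥ z)                 ≡⟨ sumℤ-cong L ∑-V-χ ⟨
    ∑[ z ] ∑[ ξ ] 𝟙 (V ξ) * χ ξ z              ≡⟨ sumℤ-swap L L (λ z ξ → 𝟙 (V ξ) * χ ξ z) ⟩
    ∑[ ξ ] ∑[ z ] 𝟙 (V ξ) * χ ξ z              ≡⟨ sumℤ-cong L (λ ξ → sumℤ-*ˡ L (𝟙 (V ξ)) (χ ξ)) ⟩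
    ∑[ ξ ] 𝟙 (V ξ) * (∑[ z ] χ ξ z)            ≡⟨ sumℤ-cong L (λ ξ → cong (𝟙 (V ξ) *_)
                                                    (trans (sumℤ-cong L (χ-comm ξ)) (∑-χ ξ))) ⟩
    ∑[ ξ ] 𝟙 (V ξ) * (2^ n * 𝟙 (eqBits ξ 𝟎))   ≡⟨ sumℤ-cong L (λ ξ → x∙yz≈z∙yx (𝟙 (V ξ)) (2^ n) _) ⟩
    ∑[ ξ ] 𝟙 (eqBits ξ 𝟎) * (2^ n * 𝟙 (V ξ))   ≡⟨ ∑-indicator-𝟎 (λ ξ → 2^ n * 𝟙 (V ξ)) ⟩
    2^ n * 𝟙 (V 𝟎)                             ≡⟨ cong (λ b → 2^ n * 𝟙 b) zero-mem ⟩
    2^ n * 1ℤ                                  ≡⟨ ℤₚ.*-identityʳ (2^ n) ⟩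
    2^ n                                       ∎)
    where
    open ≡-Reasoning
    L = allVecs n

  ∑-V-fourierSum² : ∀ (A : Subset n) →
    ∑[ ξ ] 𝟙 (V ξ) * fourierSum A ξ ² ≡ + card V * (∑[ x ] 𝟙 (A x) * + card (interCoset A x V⊥))
  ∑-V-fourierSum² A = begin
    ∑[ ξ ] 𝟙 (V ξ) * fourierSum A ξ ²
      ≡⟨ ∑-weighted-fourierSum² A (𝟙 ∘ V) ⟩
    ∑[ x ] ∑[ y ] 𝟙 (A x) * 𝟙 (A y) * (∑[ ξ ] 𝟙 (V ξ) * χ ξ (y ⊕ x))
      ≡⟨ sumℤ-cong L (λ x → sumℤ-cong L (λ y → trans (cong (𝟙 (A x) * 𝟙 (A y) *_) (∑-V-χ (y ⊕ x)))
                                                      (regroup (𝟙 (A x)) (𝟙 (A y)) (+ card V) _))) ⟩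
    ∑[ x ] ∑[ y ] + card V * 𝟙 (A x) * (𝟙 (A y) * 𝟙 (V⊥ (y ⊕ x)))
      ≡⟨ sumℤ-cong L (λ x → trans (sumℤ-*ˡ L (+ card V * 𝟙 (A x)) (λ y → 𝟙 (A y) * 𝟙 (V⊥ (y ⊕ x))))
                                  (cong (+ card V * 𝟙 (A x) *_) (sym (card-interCoset-𝟙 A x V⊥)))) ⟩
    ∑[ x ] + card V * 𝟙 (A x) * + card (interCoset A x V⊥)
      ≡⟨ sumℤ-cong L (λ x → ℤₚ.*-assoc (+ card V) (𝟙 (A x)) _) ⟩
    ∑[ x ] + card V * (𝟙 (A x) * + card (interCoset A x V⊥))
      ≡⟨ sumℤ-*ˡ L (+ card V) (λ x → 𝟙 (A x) * + card (interCoset A x V⊥)) ⟩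
    + card V * (∑[ x ] 𝟙 (A x) * + card (interCoset A x V⊥)) ∎
    where
    open ≡-Reasoning
    L = allVecs n
    regroup : ∀ a b v h → a * b * (v * h) ≡ v * a * (b * h)
    regroup = solve-∀

  ∑-V-fourierSum²≤ : ∀ (A : Subset n) m → (∀ x → card (interCoset A x V⊥) ℕ.≤ m) →
    ∑[ ξ ] 𝟙 (V ξ) * fourierSum A ξ ² ≤ + card V * (+ card A * + m)
  ∑-V-fourierSum²≤ A m coset≤m = begin
    ∑[ ξ ] 𝟙 (V ξ) * fourierSum A ξ ²
      ≡⟨ ∑-V-fourierSum² A ⟩
    + card V * (∑[ x ] 𝟙 (A x) * + card (interCoset A x V⊥))
      ≤⟨ *-monoˡ-≤-nonNeg {+ card V} (+≤+ ℕ.z≤n) (sumℤ-mono-≤ L (λ x → *-monoˡ-≤-nonNeg (𝟙-nonNeg (A x)) (+≤+ (coset≤m x)))) ⟩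
    + card V * (∑[ x ] 𝟙 (A x) * + m)
      ≡⟨ cong (+ card V *_) (trans (sumℤ-*ʳ L (+ m) (𝟙 ∘ A)) (cong (_* + m) (sym (card-𝟙 A)))) ⟩
    + card V * (+ card A * + m) ∎
    where
    open ℤₚ.≤-Reasoning
    L = allVecs n

  ∑-V-fourierSum⁴≤ : ∀ (A : Subset n) m → (∀ x → card (interCoset A x V⊥) ℕ.≤ m) →
    ∑[ ξ ] 𝟙 (V ξ) * fourierSum A ξ ⁴ ≤ (+ card A) ² * (+ card V * (+ card A * + m))
  ∑-V-fourierSum⁴≤ A m coset≤m = begin
    ∑[ ξ ] 𝟙 (V ξ) * fourierSum A ξ ⁴
      ≤⟨ sumℤ-mono-≤ L (λ ξ → *-monoˡ-≤-nonNeg (𝟙-nonNeg (V ξ)) (⁴≤card²*² ξ)) ⟩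
    ∑[ ξ ] 𝟙 (V ξ) * ((+ card A) ² * fourierSum A ξ ²)
      ≡⟨ sumℤ-cong L (λ ξ → *-x∙yz≈y∙xz (𝟙 (V ξ)) ((+ card A) ²) _) ⟩
    ∑[ ξ ] (+ card A) ² * (𝟙 (V ξ) * fourierSum A ξ ²)
      ≡⟨ sumℤ-*ˡ L ((+ card A) ²) (λ ξ → 𝟙 (V ξ) * fourierSum A ξ ²) ⟩
    (+ card A) ² * (∑[ ξ ] 𝟙 (V ξ) * fourierSum A ξ ²)
      ≤⟨ *-monoˡ-≤-nonNeg (²-nonNeg (+ card A)) (∑-V-fourierSum²≤ A m coset≤m) ⟩
    (+ card A) ² * (+ card V * (+ card A * + m)) ∎
    where
    open ℤₚ.≤-Reasoning
    L = allVecs n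
    ⁴≤card²*² : ∀ ξ → fourierSum A ξ ⁴ ≤ (+ card A) ² * fourierSum A ξ ²
    ⁴≤card²*² ξ = subst (_≤ (+ card A) ² * fourierSum A ξ ²) (sym (ℤₚ.*-assoc (F * F) F F))
                    (*-monoʳ-≤-nonNeg (²-nonNeg F) (fourierSum²≤card² A ξ))
      where F = fourierSum A ξ

  card-V>0 : 0 ℕ.< card V
  card-V>0 = ℕ.>-nonZero⁻¹ (card V) {{ℕₚ.m*n≢0⇒m≢0 (card V) {{nonZero-product}}}}
    where
    nonZero-product : ℕ.NonZero (card V ℕ.* card V⊥)
    nonZero-product = subst ℕ.NonZero (sym card-V*card-V⊥) (ℕₚ.m^n≢0 2 n)

  card-V⊥-≥ : ∀ (A : Subset n) k m → NonEmpty A →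
    (∀ ξ → V ξ ≡ true → + k * (+ card A) ² ≤ + m * fourierSum A ξ ²) →
    k ℕ.* card A ℕ.≤ m ℕ.* card V⊥
  card-V⊥-≥ A k m A≢∅ spectral = ℤₚ.drop‿+≤+ (subst₂ _≤_ (sym (ℤₚ.pos-* k (card A))) (sym (ℤₚ.pos-* m (card V⊥)))
    (ℤₚ.*-cancelˡ-≤-pos (+ k * a) (+ m * h) (v * a) {{ℤ.positive 0<v*a}} (begin
      v * a * (+ k * a)                        ≡⟨ regroupˡ v a (+ k) ⟩
      v * (+ k * a ²)                          ≡⟨ cong (_* (+ k * a ²)) (card-𝟙 V) ⟩
      (∑[ ξ ] 𝟙 (V ξ)) * (+ k * a ²)           ≡⟨ sumℤ-*ʳ L (+ k * a ²) (𝟙 ∘ V) ⟨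
      ∑[ ξ ] 𝟙 (V ξ) * (+ k * a ²)             ≤⟨ sumℤ-mono-≤ L (λ ξ → 𝟙-mono (V ξ) (spectral ξ)) ⟩
      ∑[ ξ ] 𝟙 (V ξ) * (+ m * fourierSum A ξ ²) ≡⟨ sumℤ-cong L (λ ξ → *-x∙yz≈y∙xz (𝟙 (V ξ)) (+ m) _) ⟩
      ∑[ ξ ] + m * (𝟙 (V ξ) * fourierSum A ξ ²) ≡⟨ sumℤ-*ˡ L (+ m) (λ ξ → 𝟙 (V ξ) * fourierSum A ξ ²) ⟩
      + m * (∑[ ξ ] 𝟙 (V ξ) * fourierSum A ξ ²) ≤⟨ *-monoˡ-≤-nonNeg {+ m} (+≤+ ℕ.z≤n)
                                                     (∑-V-fourierSum²≤ A (card V⊥) (λ x → card-interCoset≤card A x V⊥)) ⟩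
      + m * (v * (a * h))                       ≡⟨ regroupʳ (+ m) v a h ⟩
      v * a * (+ m * h)                         ∎)))
    where
    open ℤₚ.≤-Reasoning
    L = allVecs n
    v = + card V
    a = + card A
    h = + card V⊥
    0<v*a : 0ℤ ℤ.< v * a
    0<v*a = subst (0ℤ ℤ.<_) (ℤₚ.pos-* (card V) (card A)) (+<+ (ℕₚ.*-mono-≤ card-V>0 A≢∅))
    𝟙-mono : ∀ b {x y} → (b ≡ true → x ≤ y) → 𝟙 b * x ≤ 𝟙 b * y
    𝟙-mono false x≤y = ℤₚ.≤-refl
    𝟙-mono true  x≤y = *-monoˡ-≤-nonNeg (𝟙-nonNeg true) (x≤y refl)
    regroupˡ : ∀ v a k → v * a * (k * a) ≡ v * (k * (a * a))
    regroupˡ = solve-∀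
    regroupʳ : ∀ m v a h → m * (v * (a * h)) ≡ v * a * (m * h)
    regroupʳ = solve-∀

module RationalEmbedding where

  open import Data.Rational using (_≤_; _<_; _*_; _+_; mkℚ; *≤*; *<*)
  import Data.Nat.Coprimality as Coprimality

  -- Exposing z / 1 as a raw mkℚ lets the ℚ operations on such numbers reduce by computation.
  ℤtoℚ-mkℚ : ∀ z → ℤtoℚ z ≡ mkℚ z 0 (Coprimality.sym (Coprimality.1-coprimeTo _))
  ℤtoℚ-mkℚ (+ n)    = ℚₚ.normalize-coprime (Coprimality.sym (Coprimality.1-coprimeTo _))
  ℤtoℚ-mkℚ -[1+ n ] = cong ℚ.-_ (ℚₚ.normalize-coprime {suc n} {0} (Coprimality.sym (Coprimality.1-coprimeTo _)))

  ℤtoℚ-* : ∀ a b → ℤtoℚ (a ℤ.* b) ≡ ℤtoℚ a * ℤtoℚ b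
  ℤtoℚ-* a b rewrite ℤtoℚ-mkℚ a | ℤtoℚ-mkℚ b = refl

  ℤtoℚ-+ : ∀ a b → ℤtoℚ (a ℤ.+ b) ≡ ℤtoℚ a + ℤtoℚ b
  ℤtoℚ-+ a b rewrite ℤtoℚ-mkℚ a | ℤtoℚ-mkℚ b =
    cong₂ (λ x y → (x ℤ.+ y) ℚ./ 1) (sym (ℤₚ.*-identityʳ a)) (sym (ℤₚ.*-identityʳ b))

  ℤtoℚ-mono-≤ : ∀ {a b} → a ℤ.≤ b → ℤtoℚ a ≤ ℤtoℚ b
  ℤtoℚ-mono-≤ {a} {b} a≤b rewrite ℤtoℚ-mkℚ a | ℤtoℚ-mkℚ b =
    *≤* (subst₂ ℤ._≤_ (sym (ℤₚ.*-identityʳ a)) (sym (ℤₚ.*-identityʳ b)) a≤b)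

  ℤtoℚ-mono-< : ∀ {a b} → a ℤ.< b → ℤtoℚ a < ℤtoℚ b
  ℤtoℚ-mono-< {a} {b} a<b rewrite ℤtoℚ-mkℚ a | ℤtoℚ-mkℚ b =
    *<* (subst₂ ℤ._<_ (sym (ℤₚ.*-identityʳ a)) (sym (ℤₚ.*-identityʳ b)) a<b)

  ℤtoℚ-cancel-≤ : ∀ {a b} → ℤtoℚ a ≤ ℤtoℚ b → a ℤ.≤ b
  ℤtoℚ-cancel-≤ {a} {b} qa≤qb rewrite ℤtoℚ-mkℚ a | ℤtoℚ-mkℚ b with qa≤qb
  ... | *≤* a*1≤b*1 = subst₂ ℤ._≤_ (ℤₚ.*-identityʳ a) (ℤₚ.*-identityʳ b) a*1≤b*1

  ℤtoℚ-*⁴ : ∀ a b c d → ℤtoℚ (a ℤ.* b ℤ.* c ℤ.* d) ≡ ℤtoℚ a * ℤtoℚ b * ℤtoℚ c * ℤtoℚ d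
  ℤtoℚ-*⁴ a b c d = begin
    ℤtoℚ (a ℤ.* b ℤ.* c ℤ.* d)                ≡⟨ ℤtoℚ-* (a ℤ.* b ℤ.* c) d ⟩
    ℤtoℚ (a ℤ.* b ℤ.* c) * ℤtoℚ d             ≡⟨ cong (_* ℤtoℚ d) (ℤtoℚ-* (a ℤ.* b) c) ⟩
    ℤtoℚ (a ℤ.* b) * ℤtoℚ c * ℤtoℚ d          ≡⟨ cong (λ t → t * ℤtoℚ c * ℤtoℚ d) (ℤtoℚ-* a b) ⟩
    ℤtoℚ a * ℤtoℚ b * ℤtoℚ c * ℤtoℚ d         ∎
    where open ≡-Reasoning

  ℤtoℚ-⁴ : ∀ x → ℤtoℚ (x ⁴) ≡ pow4 (ℤtoℚ x)
  ℤtoℚ-⁴ x = ℤtoℚ-*⁴ x x x x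

  ℤtoℚ-sumℤ-≤ : ∀ {X : Set} xs c (f g : X → ℤ) → (∀ x → ℤtoℚ (f x) ≤ c * ℤtoℚ (g x)) →
                ℤtoℚ (sumℤ xs f) ≤ c * ℤtoℚ (sumℤ xs g)
  ℤtoℚ-sumℤ-≤ []       c f g f≤cg = ℚₚ.≤-reflexive (sym (ℚₚ.*-zeroʳ c))
  ℤtoℚ-sumℤ-≤ (x ∷ xs) c f g f≤cg = begin
    ℤtoℚ (f x ℤ.+ sumℤ xs f)                     ≡⟨ ℤtoℚ-+ (f x) (sumℤ xs f) ⟩
    ℤtoℚ (f x) + ℤtoℚ (sumℤ xs f)                ≤⟨ ℚₚ.+-mono-≤ (f≤cg x) (ℤtoℚ-sumℤ-≤ xs c f g f≤cg) ⟩
    c * ℤtoℚ (g x) + c * ℤtoℚ (sumℤ xs g)        ≡⟨ ℚₚ.*-distribˡ-+ c (ℤtoℚ (g x)) _ ⟨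
    c * (ℤtoℚ (g x) + ℤtoℚ (sumℤ xs g))          ≡⟨ cong (c *_) (ℤtoℚ-+ (g x) (sumℤ xs g)) ⟨
    c * ℤtoℚ (g x ℤ.+ sumℤ xs g)                 ∎
    where open ℚₚ.≤-Reasoning

open RationalEmbedding

module RationalArithmetic where

  open import Data.Rational using (_≤_; _<_; _*_; _/_)
  open import Data.Rational.Solver using (module +-*-Solver)
  open +-*-Solver using (solve; _:*_; _:=_; con)

  *-nonNeg-ℚ : ∀ {p q} → 0ℚ ≤ p → 0ℚ ≤ q → 0ℚ ≤ p * q
  *-nonNeg-ℚ {p} {q} 0≤p 0≤q =
    ℚₚ.nonNegative⁻¹ (p * q) {{ℚₚ.nonNeg*nonNeg⇒nonNeg p {{ℚ.nonNegative 0≤p}} q {{ℚ.nonNegative 0≤q}}}}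

  *-mono-≤-ℚ : ∀ {a b c d} → 0ℚ ≤ a → 0ℚ ≤ c → a ≤ b → c ≤ d → a * c ≤ b * d
  *-mono-≤-ℚ {a} {b} {c} {d} 0≤a 0≤c a≤b c≤d = ℚₚ.≤-trans (ℚₚ.*-monoˡ-≤-nonNeg a {{ℚ.nonNegative 0≤a}} c≤d)
                                                       (ℚₚ.*-monoʳ-≤-nonNeg d {{ℚ.nonNegative (ℚₚ.≤-trans 0≤c c≤d)}} a≤b)

  *⁴-mono-≤-ℚ : ∀ {a₁ a₂ a₃ a₄ b₁ b₂ b₃ b₄} → 0ℚ ≤ a₁ → 0ℚ ≤ a₂ → 0ℚ ≤ a₃ → 0ℚ ≤ a₄ →
               a₁ ≤ b₁ → a₂ ≤ b₂ → a₃ ≤ b₃ → a₄ ≤ b₄ → a₁ * a₂ * a₃ * a₄ ≤ b₁ * b₂ * b₃ * b₄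
  *⁴-mono-≤-ℚ 0≤a₁ 0≤a₂ 0≤a₃ 0≤a₄ a₁≤b₁ a₂≤b₂ a₃≤b₃ a₄≤b₄ =
    *-mono-≤-ℚ (*-nonNeg-ℚ (*-nonNeg-ℚ 0≤a₁ 0≤a₂) 0≤a₃) 0≤a₄
      (*-mono-≤-ℚ (*-nonNeg-ℚ 0≤a₁ 0≤a₂) 0≤a₃ (*-mono-≤-ℚ 0≤a₁ 0≤a₂ a₁≤b₁ a₂≤b₂) a₃≤b₃) a₄≤b₄

  pow4-pos : ∀ {x} → 0ℚ < x → 0ℚ < pow4 x
  pow4-pos {x} 0<x = ℚₚ.positive⁻¹ (pow4 x) {{pos {x * x * x} (pos {x * x} (pos {x} p p) p) p}}
    where
    p = ℚ.positive 0<x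
    pos : ∀ {a b} → ℚ.Positive a → ℚ.Positive b → ℚ.Positive (a * b)
    pos {a} {b} pa pb = ℚₚ.pos*pos⇒pos a {{pa}} b {{pb}}

  scale-ω-bound : ∀ {K N P E} → 0ℚ ≤ pow4 N → P * P * P ≤ pow4 K * pow4 E → pow4 N * (P * P * P) ≤ pow4 K * pow4 (N * E)
  scale-ω-bound {K} {N} {P} {E} 0≤N⁴ P³≤K⁴E⁴ = begin
    pow4 N * (P * P * P)          ≤⟨ ℚₚ.*-monoˡ-≤-nonNeg (pow4 N) {{ℚ.nonNegative 0≤N⁴}} P³≤K⁴E⁴ ⟩
    pow4 N * (pow4 K * pow4 E)    ≡⟨ solve 3 (λ N K E → (N :* N :* N :* N) :* ((K :* K :* K :* K) :* (E :* E :* E :* E))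
                                               := (K :* K :* K :* K) :* ((N :* E) :* (N :* E) :* (N :* E) :* (N :* E)))
                                             refl N K E ⟩
    pow4 K * pow4 (N * E)         ∎
    where open ℚₚ.≤-Reasoning

  off-spectrum-share : ∀ {K δ² Y X s} → 0ℚ < K → δ² * ((+ 2 / 1) * K) ≡ 1ℚ →
              pow4 s ≤ pow4 δ² * Y → Y ≤ pow4 K * X → ℕtoℚ 16 * pow4 s ≤ X
  off-spectrum-share {K} {δ²} {Y} {X} {s} 0<K δ²[2K]≡1 s⁴≤δ⁸Y Y≤K⁴X =
    ℚₚ.*-cancelˡ-≤-pos (pow4 K) {{ℚ.positive (pow4-pos 0<K)}} (begin
      pow4 K * (ℕtoℚ 16 * pow4 s)         ≡⟨ solve 2 (λ K s → (K :* K :* K :* K) :* (con (ℕtoℚ 16) :* (s :* s :* s :* s))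
                                                       := (con 2ℚ :* K) :* (con 2ℚ :* K) :* (con 2ℚ :* K) :* (con 2ℚ :* K)
                                                          :* (s :* s :* s :* s))
                                                     refl K s ⟩
      pow4 (2ℚ * K) * pow4 s              ≤⟨ ℚₚ.*-monoˡ-≤-nonNeg (pow4 (2ℚ * K)) {{ℚ.nonNegative 0≤[2K]⁴}} s⁴≤δ⁸Y ⟩
      pow4 (2ℚ * K) * (pow4 δ² * Y)       ≡⟨ solve 3 (λ K d Y → (con 2ℚ :* K) :* (con 2ℚ :* K) :* (con 2ℚ :* K) :* (con 2ℚ :* K)
                                                              :* ((d :* d :* d :* d) :* Y)
                                                       := (d :* (con 2ℚ :* K)) :* (d :* (con 2ℚ :* K)) :* (d :* (con 2ℚ :* K))
                                                          :* (d :* (con 2ℚ :* K)) :* Y)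
                                                     refl K δ² Y ⟩
      pow4 (δ² * (2ℚ * K)) * Y            ≡⟨ cong (λ t → pow4 t * Y) δ²[2K]≡1 ⟩
      pow4 1ℚ * Y                         ≡⟨ ℚₚ.*-identityˡ Y ⟩
      Y                                   ≤⟨ Y≤K⁴X ⟩
      pow4 K * X                          ∎)
    where
    open ℚₚ.≤-Reasoning
    2ℚ = + 2 / 1
    0≤[2K]⁴ : 0ℚ ≤ pow4 (2ℚ * K)
    0≤[2K]⁴ = ℚₚ.<⇒≤ (pow4-pos (ℚₚ.positive⁻¹ (2ℚ * K) {{ℚₚ.pos*pos⇒pos 2ℚ K {{ℚ.positive 0<K}}}}))

  density-bound : ∀ {K v h P M X} → 0ℚ < pow4 v * (P * P * P) → pow4 (v * h) * (P * P * P) ≤ pow4 K * X →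
             X ≤ ℕtoℚ 16 * (pow4 v * (P * P * P * M)) → 0ℚ ≤ pow4 K → pow4 h ≤ pow4 ((+ 2 / 1) * K) * M
  density-bound {K} {v} {h} {P} {M} {X} 0<v⁴P³ [vh]⁴P³≤K⁴X X≤16v⁴P³M 0≤K⁴ =
    ℚₚ.*-cancelˡ-≤-pos (pow4 v * (P * P * P)) {{ℚ.positive 0<v⁴P³}} (begin
      pow4 v * (P * P * P) * pow4 h                 ≡⟨ solve 3 (λ v h P → (v :* v :* v :* v) :* (P :* P :* P) :* (h :* h :* h :* h)
                                                                 := (v :* h) :* (v :* h) :* (v :* h) :* (v :* h) :* (P :* P :* P))
                                                               refl v h P ⟩
      pow4 (v * h) * (P * P * P)                    ≤⟨ [vh]⁴P³≤K⁴X ⟩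
      pow4 K * X                                    ≤⟨ ℚₚ.*-monoˡ-≤-nonNeg (pow4 K) {{ℚ.nonNegative 0≤K⁴}} X≤16v⁴P³M ⟩
      pow4 K * (ℕtoℚ 16 * (pow4 v * (P * P * P * M)))  ≡⟨ solve 4 (λ K v P M →
                                                          (K :* K :* K :* K) :* (con (ℕtoℚ 16) :* ((v :* v :* v :* v) :* (P :* P :* P :* M)))
                                                          := (v :* v :* v :* v) :* (P :* P :* P)
                                                             :* ((con 2ℚ :* K) :* (con 2ℚ :* K) :* (con 2ℚ :* K) :* (con 2ℚ :* K) :* M))
                                                        refl K v P M ⟩
      pow4 v * (P * P * P) * (pow4 (2ℚ * K) * M)    ∎)
    where
    open ℚₚ.≤-Reasoning
    2ℚ = + 2 / 1

open RationalArithmetic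

module Spectra {n : ℕ} where

  open import Data.Rational using (_≤_; _<_; _*_; _/_)
  open import Data.Integer using (0ℤ; 1ℤ)
  open import Relation.Nullary.Decidable using (Dec; isYes; toWitness; fromWitness)
  open import Function.Bundles using (_⇔_; mk⇔; Equivalence)

  InSpec²? : ∀ α² (A : Subset n) ξ → Dec (InSpec² α² A ξ)
  InSpec²? α² A ξ = α² * (ℕtoℚ (card A) * ℕtoℚ (card A)) ℚₚ.≤? ℤtoℚ (fourierSum A ξ) * ℤtoℚ (fourierSum A ξ)

  Spec : ℚ → Subset n → Subset n
  Spec α² A ξ = isYes (InSpec²? α² A ξ)

  Spec-sound : ∀ α² (A : Subset n) ξ → Spec α² A ξ ≡ true → InSpec² α² A ξ
  Spec-sound α² A ξ ξ∈Spec = toWitness {a? = InSpec²? α² A ξ} (Equivalence.from (Boolₚ.T-≡ {Spec α² A ξ}) ξ∈Spec)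

  Spec-complete : ∀ α² (A : Subset n) ξ → InSpec² α² A ξ → Spec α² A ξ ≡ true
  Spec-complete α² A ξ ξ∈Spec = Equivalence.to (Boolₚ.T-≡ {Spec α² A ξ}) (fromWitness {a? = InSpec²? α² A ξ} ξ∈Spec)

  InSpec²-anti : ∀ (A : Subset n) ξ {α² β²} → α² ≤ β² → InSpec² β² A ξ → InSpec² α² A ξ
  InSpec²-anti A ξ α²≤β² = ℚₚ.≤-trans (ℚₚ.*-monoʳ-≤-nonNeg (ℕtoℚ (card A) * ℕtoℚ (card A)) {{ℚ.nonNegative c²≥0}} α²≤β²)
    where
    c²≥0 : 0ℚ ≤ ℕtoℚ (card A) * ℕtoℚ (card A)
    c²≥0 = subst (0ℚ ≤_) (ℤtoℚ-* (+ card A) (+ card A)) (ℤtoℚ-mono-≤ (²-nonNeg (+ card A)))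

  InSpec²⇔ℤ : ∀ α² k m .{{_ : ℕ.NonZero m}} → ℕtoℚ m * α² ≡ ℕtoℚ k → ∀ (A : Subset n) ξ →
              InSpec² α² A ξ ⇔ (+ k ℤ.* (+ card A) ² ℤ.≤ + m ℤ.* fourierSum A ξ ²)
  InSpec²⇔ℤ α² k m mα²≡k A ξ = mk⇔
    (λ ξ∈Spec → ℤtoℚ-cancel-≤ (begin
      ℤtoℚ (+ k ℤ.* c ²)            ≡⟨ scaled k c ⟩
      ℕtoℚ k * ℤtoℚ (c ²)           ≡⟨ cong (_* ℤtoℚ (c ²)) mα²≡k ⟨
      ℕtoℚ m * α² * ℤtoℚ (c ²)      ≡⟨ ℚₚ.*-assoc (ℕtoℚ m) α² _ ⟩
      ℕtoℚ m * (α² * ℤtoℚ (c ²))    ≤⟨ ℚₚ.*-monoˡ-≤-nonNeg (ℕtoℚ m) {{ℚ.nonNegative m≥0}} (spec⇒ ξ∈Spec) ⟩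
      ℕtoℚ m * ℤtoℚ (F ²)           ≡⟨ scaled m F ⟨
      ℤtoℚ (+ m ℤ.* F ²)            ∎))
    (λ k*c²≤m*F² → spec⇐ (ℚₚ.*-cancelˡ-≤-pos (ℕtoℚ m) {{ℚ.positive m>0}} (begin
      ℕtoℚ m * (α² * ℤtoℚ (c ²))    ≡⟨ ℚₚ.*-assoc (ℕtoℚ m) α² _ ⟨
      ℕtoℚ m * α² * ℤtoℚ (c ²)      ≡⟨ cong (_* ℤtoℚ (c ²)) mα²≡k ⟩
      ℕtoℚ k * ℤtoℚ (c ²)           ≡⟨ scaled k c ⟨
      ℤtoℚ (+ k ℤ.* c ²)            ≤⟨ ℤtoℚ-mono-≤ k*c²≤m*F² ⟩
      ℤtoℚ (+ m ℤ.* F ²)            ≡⟨ scaled m F ⟩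
      ℕtoℚ m * ℤtoℚ (F ²)           ∎)))
    where
    open ℚₚ.≤-Reasoning
    c = + card A
    F = fourierSum A ξ
    scaled : ∀ j x → ℤtoℚ (+ j ℤ.* x ²) ≡ ℕtoℚ j * ℤtoℚ (x ²)
    scaled j x = ℤtoℚ-* (+ j) (x ²)
    spec⇒ : InSpec² α² A ξ → α² * ℤtoℚ (c ²) ≤ ℤtoℚ (F ²)
    spec⇒ = subst₂ (λ u v → α² * u ≤ v) (sym (ℤtoℚ-* c c)) (sym (ℤtoℚ-* F F))
    spec⇐ : α² * ℤtoℚ (c ²) ≤ ℤtoℚ (F ²) → InSpec² α² A ξ
    spec⇐ = subst₂ (λ u v → α² * u ≤ v) (ℤtoℚ-* c c) (ℤtoℚ-* F F)
    m≥0 : 0ℚ ≤ ℕtoℚ m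
    m≥0 = ℤtoℚ-mono-≤ {+ 0} {+ m} (+≤+ ℕ.z≤n)
    m>0 : 0ℚ < ℕtoℚ m
    m>0 = ℤtoℚ-mono-< {+ 0} {+ m} (+<+ (ℕ.>-nonZero⁻¹ m))

  scaled-²≤⇔ℕ : ∀ k m x y →
                + k ℤ.* x ² ℤ.≤ + m ℤ.* y ² ⇔ k ℕ.* (ℤ.∣ x ∣ ℕ.* ℤ.∣ x ∣) ℕ.≤ m ℕ.* (ℤ.∣ y ∣ ℕ.* ℤ.∣ y ∣)
  scaled-²≤⇔ℕ k m x y = mk⇔
    (λ kx²≤my² → ℤₚ.drop‿+≤+ (subst₂ ℤ._≤_ (as-ℕ k x) (as-ℕ m y) kx²≤my²))
    (λ kx²≤my² → subst₂ ℤ._≤_ (sym (as-ℕ k x)) (sym (as-ℕ m y)) (+≤+ kx²≤my²))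
    where
    as-ℕ : ∀ j z → + j ℤ.* z ² ≡ + (j ℕ.* (ℤ.∣ z ∣ ℕ.* ℤ.∣ z ∣))
    as-ℕ j z = trans (cong (+ j ℤ.*_) (²-∣∣ z)) (sym (ℤₚ.pos-* j _))

  InSpec910⇔ℤ : ∀ (A : Subset n) ξ → InSpec910 A ξ ⇔ (+ 81 ℤ.* (+ card A) ² ℤ.≤ + 100 ℤ.* fourierSum A ξ ²)
  InSpec910⇔ℤ = InSpec²⇔ℤ (+ 81 / 100) 81 100 refl

  Spec910-isSubspace : ∀ (A : Subset n) {δ²} → δ² ≤ + 64 / 100 → (∀ ξ → InSpec² δ² A ξ → InSpec910 A ξ) →
                       IsSubspace (Spec (+ 81 / 100) A)
  Spec910-isSubspace A {δ²} δ²≤64/100 Specδ⊆Spec910 = record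
    { zero-mem = Spec-complete (+ 81 / 100) A 𝟎 (Equivalence.from (InSpec910⇔ℤ A 𝟎) 𝟎∈Spec910)
    ; add-mem  = λ ξ η ξ∈V η∈V → Spec-complete (+ 81 / 100) A (ξ ⊕ η) (Specδ⊆Spec910 (ξ ⊕ η)
        (InSpec²-anti A (ξ ⊕ η) δ²≤64/100 (Equivalence.from (InSpec²⇔ℤ (+ 64 / 100) 64 100 refl A (ξ ⊕ η))
          (Equivalence.from (scaled-²≤⇔ℕ 64 100 (+ card A) (fourierSum A (ξ ⊕ η)))
            (≥9/10∧≥9/10⇒≥8/10 ℤ.∣ fourierSum A ξ ∣ ℤ.∣ fourierSum A η ∣ (card A) ℤ.∣ fourierSum A (ξ ⊕ η) ∣
                               (large ξ ξ∈V) (large η η∈V) (∣fourierSum∣-triangle A ξ η))))))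
    }
    where
    𝟎∈Spec910 : + 81 ℤ.* (+ card A) ² ℤ.≤ + 100 ℤ.* fourierSum A 𝟎 ²
    𝟎∈Spec910 = subst (λ F → + 81 ℤ.* (+ card A) ² ℤ.≤ + 100 ℤ.* F ²) (sym (fourierSum-𝟎 A))
                  (*-monoʳ-≤-nonNeg {(+ card A) ²} {+ 81} {+ 100} (²-nonNeg (+ card A)) (+≤+ (ℕₚ.m≤m+n 81 19)))
    large : ∀ ξ → Spec (+ 81 / 100) A ξ ≡ true →
            81 ℕ.* (card A ℕ.* card A) ℕ.≤ 100 ℕ.* (ℤ.∣ fourierSum A ξ ∣ ℕ.* ℤ.∣ fourierSum A ξ ∣)
    large ξ ξ∈V = Equivalence.to (scaled-²≤⇔ℕ 81 100 (+ card A) (fourierSum A ξ))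
                    (Equivalence.to (InSpec910⇔ℤ A ξ) (Spec-sound (+ 81 / 100) A ξ ξ∈V))

  ∑-off-spectrum-fourierSum⁴ : ∀ (A W : Subset n) {α²} → 0ℚ ≤ α² → (∀ ξ → W ξ ≡ true → ¬ InSpec² α² A ξ) →
    ℤtoℚ (∑[ ξ ] 𝟙 (W ξ) ℤ.* fourierSum A ξ ⁴) ≤ α² * ℤtoℚ ((+ card A) ² ℤ.* (2^ n ℤ.* + card A))
  ∑-off-spectrum-fourierSum⁴ A W {α²} α²≥0 off = begin
    ℤtoℚ (∑[ ξ ] 𝟙 (W ξ) ℤ.* fourierSum A ξ ⁴)     ≤⟨ ℤtoℚ-sumℤ-≤ L α² (λ ξ → 𝟙 (W ξ) ℤ.* fourierSum A ξ ⁴)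
                                                         (λ ξ → c ² ℤ.* fourierSum A ξ ²) (λ ξ → pointwise ξ (W ξ) (off ξ)) ⟩
    α² * ℤtoℚ (∑[ ξ ] c ² ℤ.* fourierSum A ξ ²)    ≡⟨ cong (λ t → α² * ℤtoℚ t)
                                                         (trans (sumℤ-*ˡ L (c ²) (λ ξ → fourierSum A ξ ²)) (cong (c ² ℤ.*_) (parseval A))) ⟩
    α² * ℤtoℚ (c ² ℤ.* (2^ n ℤ.* c))               ∎
    where
    open ℚₚ.≤-Reasoning
    L = allVecs n
    c = + card A
    nonNeg : ∀ {z} → 0ℤ ℤ.≤ z → 0ℚ ≤ ℤtoℚ z
    nonNeg = ℤtoℚ-mono-≤ {0ℤ}
    pointwise : ∀ ξ b → (b ≡ true → ¬ InSpec² α² A ξ) →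
                ℤtoℚ (𝟙 b ℤ.* fourierSum A ξ ⁴) ≤ α² * ℤtoℚ (c ² ℤ.* fourierSum A ξ ²)
    pointwise ξ false _   = *-nonNeg-ℚ α²≥0 (nonNeg (*-nonNeg (²-nonNeg c) (²-nonNeg (fourierSum A ξ))))
    pointwise ξ true  off = begin
      ℤtoℚ (1ℤ ℤ.* F ⁴)                        ≡⟨ cong ℤtoℚ (trans (ℤₚ.*-identityˡ (F ⁴)) (ℤₚ.*-assoc (F ℤ.* F) F F)) ⟩
      ℤtoℚ (F ² ℤ.* F ²)                      ≡⟨ ℤtoℚ-* (F ²) (F ²) ⟩
      ℤtoℚ (F ²) * ℤtoℚ (F ²)                 ≤⟨ ℚₚ.*-monoʳ-≤-nonNeg (ℤtoℚ (F ²)) {{ℚ.nonNegative (nonNeg (²-nonNeg F))}}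
                                                    (ℚₚ.<⇒≤ (ℚₚ.≰⇒> (λ α²c²≤F² → off refl (inSpec α²c²≤F²)))) ⟩
      α² * ℤtoℚ (c ²) * ℤtoℚ (F ²)            ≡⟨ ℚₚ.*-assoc α² _ _ ⟩
      α² * (ℤtoℚ (c ²) * ℤtoℚ (F ²))          ≡⟨ cong (α² *_) (ℤtoℚ-* (c ²) (F ²)) ⟨
      α² * ℤtoℚ (c ² ℤ.* F ²)                 ∎
      where
      F = fourierSum A ξ
      inSpec : α² * ℤtoℚ (c ²) ≤ ℤtoℚ (F ²) → InSpec² α² A ξ
      inSpec = subst₂ (λ u v → α² * u ≤ v) (ℤtoℚ-* c c) (ℤtoℚ-* F F)

module Proposition {n} (K : ℚ) (1≤K : 1ℚ ℚ.≤ K) (A₁ A₂ A₃ A₄ : Subset n)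
                   (δ² : ℚ) (δ²[2K]≡1 : δ² ℚ.* ((+ 2 ℚ./ 1) ℚ.* K) ≡ 1ℚ) (flat : CoherentlyFlat² δ² A₁ A₂ A₃ A₄) where

  open import Data.Rational using (_≤_; _<_; _*_; _/_)
  open import Data.Integer using (0ℤ)
  open import Relation.Nullary.Decidable using (toWitness)
  open import Function.Bundles using (Equivalence)
  open Spectra {n}
  open import Data.List.Extrema.Nat using (argmax; f[xs]≤f[argmax])
  import Data.List.Relation.Unary.All as All

  0<K : 0ℚ < K
  0<K = ℚₚ.<-≤-trans (toWitness {a? = 0ℚ ℚₚ.<? 1ℚ} _) 1≤K

  0<δ² : 0ℚ < δ²
  0<δ² = ℚₚ.≰⇒> (λ δ²≤0 → ℚₚ.<-irrefl refl (ℚₚ.<-≤-trans (toWitness {a? = 0ℚ ℚₚ.<? 1ℚ} _) (begin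
    1ℚ                        ≡⟨ δ²[2K]≡1 ⟨
    δ² * (2ℚ * K)             ≤⟨ ℚₚ.*-monoʳ-≤-nonNeg (2ℚ * K) {{ℚ.nonNegative 0≤2K}} δ²≤0 ⟩
    0ℚ * (2ℚ * K)             ≡⟨ ℚₚ.*-zeroˡ (2ℚ * K) ⟩
    0ℚ                        ∎)))
    where
    open ℚₚ.≤-Reasoning
    2ℚ = + 2 / 1
    0≤2K : 0ℚ ≤ 2ℚ * K
    0≤2K = *-nonNeg-ℚ (toWitness {a? = 0ℚ ℚₚ.≤? 2ℚ} _) (ℚₚ.<⇒≤ 0<K)

  δ²≤64/100 : δ² ≤ + 64 / 100
  δ²≤64/100 = begin
    δ²                                ≡⟨ ℚₚ.*-identityʳ δ² ⟨
    δ² * 1ℚ                           ≤⟨ ℚₚ.*-monoˡ-≤-nonNeg δ² {{ℚ.nonNegative (ℚₚ.<⇒≤ 0<δ²)}} 1≤[64/100][2K] ⟩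
    δ² * (+ 64 / 100 * (2ℚ * K))      ≡⟨ x∙yz≈y∙xz δ² (+ 64 / 100) (2ℚ * K) ⟩
    + 64 / 100 * (δ² * (2ℚ * K))      ≡⟨ cong (+ 64 / 100 *_) δ²[2K]≡1 ⟩
    + 64 / 100 * 1ℚ                   ≡⟨ ℚₚ.*-identityʳ (+ 64 / 100) ⟩
    + 64 / 100                        ∎
    where
    open ℚₚ.≤-Reasoning
    open CommSemigroupₚ (CommutativeMonoid.commutativeSemigroup ℚₚ.*-1-commutativeMonoid) using (x∙yz≈y∙xz)
    2ℚ = + 2 / 1
    1≤[64/100][2K] : 1ℚ ≤ + 64 / 100 * (2ℚ * K)
    1≤[64/100][2K] = ℚₚ.≤-trans (toWitness {a? = 1ℚ ℚₚ.≤? + 64 / 100 * (2ℚ * 1ℚ)} _)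
      (ℚₚ.*-monoˡ-≤-nonNeg (+ 64 / 100) (ℚₚ.*-monoˡ-≤-nonNeg 2ℚ 1≤K))

  δ²≤81/100 : δ² ≤ + 81 / 100
  δ²≤81/100 = ℚₚ.≤-trans δ²≤64/100 (toWitness {a? = + 64 / 100 ℚₚ.≤? + 81 / 100} _)

  V : Subset n
  V = Spec (+ 81 / 100) A₁

  Specδ⊆Spec910 : ∀ ξ → InSpec² δ² A₁ ξ → InSpec910 A₁ ξ
  Specδ⊆Spec910 ξ ξ∈Specδ = [ proj₁ , (λ small → ⊥-elim (proj₁ small ξ∈Specδ)) ]′ (flat ξ)

  V-isSubspace : IsSubspace V
  V-isSubspace = Spec910-isSubspace A₁ δ²≤64/100 Specδ⊆Spec910

  on-V : ∀ ξ → V ξ ≡ true → InSpec910 A₁ ξ × InSpec910 A₂ ξ × InSpec910 A₃ ξ × InSpec910 A₄ ξ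
  on-V ξ ξ∈V = [ id , (λ small → ⊥-elim (proj₁ small (InSpec²-anti A₁ ξ δ²≤81/100 (Spec-sound (+ 81 / 100) A₁ ξ ξ∈V)))) ]′
                 (flat ξ)

  off-V : ∀ ξ → not (V ξ) ≡ true → ¬ InSpec² δ² A₁ ξ × ¬ InSpec² δ² A₂ ξ × ¬ InSpec² δ² A₃ ξ × ¬ InSpec² δ² A₄ ξ
  off-V ξ ξ∉V = [ (λ large → ⊥-elim (Boolₚ.not-¬ refl (trans (Spec-complete (+ 81 / 100) A₁ ξ (proj₁ large)) (sym ξ∉V))))
                 , id ]′ (flat ξ)

  open Annihilator V V-isSubspace public using (V⊥; V⊥-isSubspace; card-V*card-V⊥; card-V>0; card-V⊥-≥; ∑-V-fourierSum⁴≤)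

  81*card≤100*card-V⊥ : ∀ (A : Subset n) → NonEmpty A → (∀ ξ → V ξ ≡ true → InSpec910 A ξ) → 81 ℕ.* card A ℕ.≤ 100 ℕ.* card V⊥
  81*card≤100*card-V⊥ A A≢∅ V⊆Spec910 = card-V⊥-≥ A 81 100 A≢∅ (λ ξ ξ∈V → Equivalence.to (InSpec910⇔ℤ A ξ) (V⊆Spec910 ξ ξ∈V))

  densest-coset : Subset n → 𝔽₂^ n
  densest-coset A = argmax (λ x → card (interCoset A x V⊥)) 𝟎 (allVecs n)

  densest-card : Subset n → ℕ
  densest-card A = card (interCoset A (densest-coset A) V⊥)

  densest-coset-max : ∀ (A : Subset n) x → card (interCoset A x V⊥) ℕ.≤ densest-card A
  densest-coset-max A x = All.lookup (f[xs]≤f[argmax] 𝟎 (allVecs n)) (∈-allVecs x)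

  size-bound : NonEmpty A₁ → NonEmpty A₂ → NonEmpty A₃ → NonEmpty A₄ →
    256 ℕ.* (card A₁ ℕ.* card A₂ ℕ.* card A₃ ℕ.* card A₄) ℕ.≤ 625 ℕ.* (card V⊥ ℕ.* card V⊥ ℕ.* card V⊥ ℕ.* card V⊥)
  size-bound A₁≢∅ A₂≢∅ A₃≢∅ A₄≢∅ = four-fifths⁴ (card A₁) (card A₂) (card A₃) (card A₄) (card V⊥)
    (81*card≤100*card-V⊥ A₁ A₁≢∅ (λ ξ → proj₁ ∘ on-V ξ))
    (81*card≤100*card-V⊥ A₂ A₂≢∅ (λ ξ → proj₁ ∘ proj₂ ∘ on-V ξ))
    (81*card≤100*card-V⊥ A₃ A₃≢∅ (λ ξ → proj₁ ∘ proj₂ ∘ proj₂ ∘ on-V ξ))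
    (81*card≤100*card-V⊥ A₄ A₄≢∅ (λ ξ → proj₂ ∘ proj₂ ∘ proj₂ ∘ on-V ξ))

  G : 𝔽₂^ n → ℤ
  G ξ = fourierSum A₁ ξ ℤ.* fourierSum A₂ ξ ℤ.* fourierSum A₃ ξ ℤ.* fourierSum A₄ ξ

  on off : ℤ
  on  = ∑[ ξ ] 𝟙 (V ξ) ℤ.* G ξ
  off = ∑[ ξ ] 𝟙 (not (V ξ)) ℤ.* G ξ

  N P M : ℤ
  N = 2^ n
  P = + card A₁ ℤ.* + card A₂ ℤ.* + card A₃ ℤ.* + card A₄
  M = + densest-card A₁ ℤ.* + densest-card A₂ ℤ.* + densest-card A₃ ℤ.* + densest-card A₄

  energy-split : N ℤ.* + energyCount A₁ A₂ A₃ A₄ ≡ on ℤ.+ off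
  energy-split = trans (energy-fourierSum A₁ A₂ A₃ A₄) (sumℤ-partition (allVecs n) V G)

  off⁴-bound : ℤtoℚ (off ⁴) ≤ pow4 δ² * ℤtoℚ (N ⁴ ℤ.* (P ℤ.* P ℤ.* P))
  off⁴-bound = begin
    ℤtoℚ (off ⁴)
      ≤⟨ ℤtoℚ-mono-≤ (hölder⁴-𝟙 (allVecs n) (not ∘ V) (fourierSum A₁) (fourierSum A₂) (fourierSum A₃) (fourierSum A₄)) ⟩
    ℤtoℚ (Q A₁ ℤ.* Q A₂ ℤ.* Q A₃ ℤ.* Q A₄)
      ≡⟨ ℤtoℚ-*⁴ (Q A₁) (Q A₂) (Q A₃) (Q A₄) ⟩
    ℤtoℚ (Q A₁) * ℤtoℚ (Q A₂) * ℤtoℚ (Q A₃) * ℤtoℚ (Q A₄)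
      ≤⟨ *⁴-mono-≤-ℚ (Q≥0 A₁) (Q≥0 A₂) (Q≥0 A₃) (Q≥0 A₄)
                    (Q≤ A₁ (λ ξ → proj₁ ∘ off-V ξ)) (Q≤ A₂ (λ ξ → proj₁ ∘ proj₂ ∘ off-V ξ))
                    (Q≤ A₃ (λ ξ → proj₁ ∘ proj₂ ∘ proj₂ ∘ off-V ξ)) (Q≤ A₄ (λ ξ → proj₂ ∘ proj₂ ∘ proj₂ ∘ off-V ξ)) ⟩
    δ² * ℤtoℚ (Y A₁) * (δ² * ℤtoℚ (Y A₂)) * (δ² * ℤtoℚ (Y A₃)) * (δ² * ℤtoℚ (Y A₄))
      ≡⟨ solve 5 (λ d y₁ y₂ y₃ y₄ → d :* y₁ :* (d :* y₂) :* (d :* y₃) :* (d :* y₄) := (d :* d :* d :* d) :* (y₁ :* y₂ :* y₃ :* y₄))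
               refl δ² (ℤtoℚ (Y A₁)) (ℤtoℚ (Y A₂)) (ℤtoℚ (Y A₃)) (ℤtoℚ (Y A₄)) ⟩
    pow4 δ² * (ℤtoℚ (Y A₁) * ℤtoℚ (Y A₂) * ℤtoℚ (Y A₃) * ℤtoℚ (Y A₄))
      ≡⟨ cong (pow4 δ² *_) (trans (sym (ℤtoℚ-*⁴ (Y A₁) (Y A₂) (Y A₃) (Y A₄)))
                                  (cong ℤtoℚ (∏Y N (+ card A₁) (+ card A₂) (+ card A₃) (+ card A₄)))) ⟩
    pow4 δ² * ℤtoℚ (N ⁴ ℤ.* (P ℤ.* P ℤ.* P)) ∎
    where
    open ℚₚ.≤-Reasoning
    open import Data.Rational.Solver using (module +-*-Solver)
    open +-*-Solver using (solve; _:*_; _:=_)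
    open import Data.Integer.Tactic.RingSolver using (solve-∀)
    Q Y : Subset n → ℤ
    Q A = ∑[ ξ ] 𝟙 (not (V ξ)) ℤ.* fourierSum A ξ ⁴
    Y A = (+ card A) ² ℤ.* (N ℤ.* + card A)
    Q≥0 : ∀ A → 0ℚ ≤ ℤtoℚ (Q A)
    Q≥0 A = ℤtoℚ-mono-≤ (sumℤ-nonNeg (allVecs n) (λ ξ → *-nonNeg (𝟙-nonNeg (not (V ξ))) (⁴-nonNeg (fourierSum A ξ))))
    Q≤ : ∀ A → (∀ ξ → not (V ξ) ≡ true → ¬ InSpec² δ² A ξ) → ℤtoℚ (Q A) ≤ δ² * ℤtoℚ (Y A)
    Q≤ A small = ∑-off-spectrum-fourierSum⁴ A (not ∘ V) (ℚₚ.<⇒≤ 0<δ²) small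
    ∏Y : ∀ N c₁ c₂ c₃ c₄ →
         c₁ ℤ.* c₁ ℤ.* (N ℤ.* c₁) ℤ.* (c₂ ℤ.* c₂ ℤ.* (N ℤ.* c₂))
           ℤ.* (c₃ ℤ.* c₃ ℤ.* (N ℤ.* c₃)) ℤ.* (c₄ ℤ.* c₄ ℤ.* (N ℤ.* c₄))
         ≡ N ℤ.* N ℤ.* N ℤ.* N
           ℤ.* ((c₁ ℤ.* c₂ ℤ.* c₃ ℤ.* c₄) ℤ.* (c₁ ℤ.* c₂ ℤ.* c₃ ℤ.* c₄) ℤ.* (c₁ ℤ.* c₂ ℤ.* c₃ ℤ.* c₄))
    ∏Y = solve-∀

  on⁴-bound : on ⁴ ℤ.≤ (+ card V) ⁴ ℤ.* (P ℤ.* P ℤ.* P ℤ.* M)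
  on⁴-bound = begin
    on ⁴
      ≤⟨ hölder⁴-𝟙 (allVecs n) V (fourierSum A₁) (fourierSum A₂) (fourierSum A₃) (fourierSum A₄) ⟩
    R A₁ ℤ.* R A₂ ℤ.* R A₃ ℤ.* R A₄
      ≤⟨ *⁴-mono-≤-nonNeg (R≥0 A₁) (R≥0 A₂) (R≥0 A₃) (R≥0 A₄) (R≤ A₁) (R≤ A₂) (R≤ A₃) (R≤ A₄) ⟩
    B A₁ ℤ.* B A₂ ℤ.* B A₃ ℤ.* B A₄
      ≡⟨ ∏B (+ card V) (+ card A₁) (+ card A₂) (+ card A₃) (+ card A₄) (m A₁) (m A₂) (m A₃) (m A₄) ⟩
    (+ card V) ⁴ ℤ.* (P ℤ.* P ℤ.* P ℤ.* M) ∎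
    where
    open ℤₚ.≤-Reasoning
    open import Data.Integer.Tactic.RingSolver using (solve-∀)
    m : Subset n → ℤ
    m A = + densest-card A
    R B : Subset n → ℤ
    R A = ∑[ ξ ] 𝟙 (V ξ) ℤ.* fourierSum A ξ ⁴
    B A = (+ card A) ² ℤ.* (+ card V ℤ.* (+ card A ℤ.* m A))
    R≥0 : ∀ A → 0ℤ ℤ.≤ R A
    R≥0 A = sumℤ-nonNeg (allVecs n) (λ ξ → *-nonNeg (𝟙-nonNeg (V ξ)) (⁴-nonNeg (fourierSum A ξ)))
    R≤ : ∀ A → R A ℤ.≤ B A
    R≤ A = ∑-V-fourierSum⁴≤ A (densest-card A) (densest-coset-max A)
    ∏B : ∀ v c₁ c₂ c₃ c₄ m₁ m₂ m₃ m₄ →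
         c₁ ℤ.* c₁ ℤ.* (v ℤ.* (c₁ ℤ.* m₁)) ℤ.* (c₂ ℤ.* c₂ ℤ.* (v ℤ.* (c₂ ℤ.* m₂)))
         ℤ.* (c₃ ℤ.* c₃ ℤ.* (v ℤ.* (c₃ ℤ.* m₃))) ℤ.* (c₄ ℤ.* c₄ ℤ.* (v ℤ.* (c₄ ℤ.* m₄)))
         ≡ v ℤ.* v ℤ.* v ℤ.* v ℤ.* ((c₁ ℤ.* c₂ ℤ.* c₃ ℤ.* c₄) ℤ.* (c₁ ℤ.* c₂ ℤ.* c₃ ℤ.* c₄) ℤ.* (c₁ ℤ.* c₂ ℤ.* c₃ ℤ.* c₄)
                                     ℤ.* (m₁ ℤ.* m₂ ℤ.* m₃ ℤ.* m₄))
    ∏B = solve-∀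

  coset-bound : NonEmpty A₁ → NonEmpty A₂ → NonEmpty A₃ → NonEmpty A₄ → ωAtLeastInv K A₁ A₂ A₃ A₄ →
    pow4 (ℕtoℚ (card V⊥)) ≤ pow4 ((+ 2 / 1) * K) * ℕtoℚ (densest-card A₁ ℕ.* densest-card A₂ ℕ.* densest-card A₃ ℕ.* densest-card A₄)
  coset-bound A₁≢∅ A₂≢∅ A₃≢∅ A₄≢∅ ω≥1/K =
    subst (λ t → pow4 h ≤ pow4 ((+ 2 / 1) * K) * t)
          (sym (ℕtoℚ-*⁴ (densest-card A₁) (densest-card A₂) (densest-card A₃) (densest-card A₄)))
      (density-bound {K} {v} {h} {Pq} {ℤtoℚ M} {X} 0<v⁴P³ (subst (λ t → pow4 t * P³ ≤ pow4 K * X) N≡vh ωs) X≤16v⁴P³M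
                     (ℚₚ.<⇒≤ (pow4-pos 0<K)))
    where
    open ℚₚ.≤-Reasoning
    ℕtoℚ-*⁴ : ∀ a b c d → ℕtoℚ (a ℕ.* b ℕ.* c ℕ.* d) ≡ ℤtoℚ (+ a ℤ.* + b ℤ.* + c ℤ.* + d)
    ℕtoℚ-*⁴ a b c d = cong ℤtoℚ (trans (ℤₚ.pos-* (a ℕ.* b ℕ.* c) d)
                                 (cong (ℤ._* + d) (trans (ℤₚ.pos-* (a ℕ.* b) c) (cong (ℤ._* + c) (ℤₚ.pos-* a b)))))
    Nq E Pq X v h : ℚ
    Nq = ℤtoℚ N
    E  = ℕtoℚ (energyCount A₁ A₂ A₃ A₄)
    Pq = ℕtoℚ (card A₁ ℕ.* card A₂ ℕ.* card A₃ ℕ.* card A₄)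
    X  = pow4 (Nq * E)
    v  = ℕtoℚ (card V)
    h  = ℕtoℚ (card V⊥)
    P³ = Pq * Pq * Pq
    Pq≡P : Pq ≡ ℤtoℚ P
    Pq≡P = ℕtoℚ-*⁴ (card A₁) (card A₂) (card A₃) (card A₄)
    ℤtoℚ-P³ : ℤtoℚ (P ℤ.* P ℤ.* P) ≡ P³
    ℤtoℚ-P³ = trans (ℤtoℚ-* (P ℤ.* P) P) (trans (cong (_* ℤtoℚ P) (ℤtoℚ-* P P)) (cong (λ t → t * t * t) (sym Pq≡P)))
    Y≡N⁴P³ : ℤtoℚ (N ⁴ ℤ.* (P ℤ.* P ℤ.* P)) ≡ pow4 Nq * P³
    Y≡N⁴P³ = trans (ℤtoℚ-* (N ⁴) (P ℤ.* P ℤ.* P)) (cong₂ _*_ (ℤtoℚ-⁴ N) ℤtoℚ-P³)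
    X≡[on+off]⁴ : X ≡ ℤtoℚ ((on ℤ.+ off) ⁴)
    X≡[on+off]⁴ = trans (cong pow4 (sym (ℤtoℚ-* N (+ energyCount A₁ A₂ A₃ A₄))))
                        (trans (sym (ℤtoℚ-⁴ (N ℤ.* + energyCount A₁ A₂ A₃ A₄))) (cong (ℤtoℚ ∘ _⁴) energy-split))
    ωs : pow4 Nq * P³ ≤ pow4 K * X
    ωs = scale-ω-bound {K} {Nq} {Pq} {E} (ℚₚ.<⇒≤ (pow4-pos 0<Nq)) ω≥1/K
      where
      0<Nq : 0ℚ < Nq
      0<Nq = ℤtoℚ-mono-< {0ℤ} {N} (+<+ (ℕ.>-nonZero⁻¹ (2 ℕ.^ n) {{ℕₚ.m^n≢0 2 n}}))
    16off⁴≤X : ℕtoℚ 16 * pow4 (ℤtoℚ off) ≤ X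
    16off⁴≤X = off-spectrum-share {K} {δ²} {pow4 Nq * P³} {X} {ℤtoℚ off} 0<K δ²[2K]≡1
      (subst₂ (λ a b → a ≤ pow4 δ² * b) (ℤtoℚ-⁴ off) Y≡N⁴P³ off⁴-bound) ωs
    16off⁴≤[on+off]⁴ : + 16 ℤ.* off ⁴ ℤ.≤ (on ℤ.+ off) ⁴
    16off⁴≤[on+off]⁴ = ℤtoℚ-cancel-≤ (subst₂ _≤_ (trans (cong (ℕtoℚ 16 *_) (sym (ℤtoℚ-⁴ off))) (sym (ℤtoℚ-* (+ 16) (off ⁴))))
                                                  X≡[on+off]⁴ 16off⁴≤X)
    [on+off]⁴≤16v⁴P³M : (on ℤ.+ off) ⁴ ℤ.≤ + 16 ℤ.* ((+ card V) ⁴ ℤ.* (P ℤ.* P ℤ.* P ℤ.* M))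
    [on+off]⁴≤16v⁴P³M = ℤₚ.≤-trans ([x+y]⁴≤16x⁴ on off 16off⁴≤[on+off]⁴) (*-monoˡ-≤-nonNeg {+ 16} (+≤+ ℕ.z≤n) on⁴-bound)
    X≤16v⁴P³M : X ≤ ℕtoℚ 16 * (pow4 v * (P³ * ℤtoℚ M))
    X≤16v⁴P³M = begin
      X                                                         ≡⟨ X≡[on+off]⁴ ⟩
      ℤtoℚ ((on ℤ.+ off) ⁴)                                     ≤⟨ ℤtoℚ-mono-≤ [on+off]⁴≤16v⁴P³M ⟩
      ℤtoℚ (+ 16 ℤ.* ((+ card V) ⁴ ℤ.* (P ℤ.* P ℤ.* P ℤ.* M)))  ≡⟨ ℤtoℚ-* (+ 16) ((+ card V) ⁴ ℤ.* (P ℤ.* P ℤ.* P ℤ.* M)) ⟩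
      ℕtoℚ 16 * ℤtoℚ ((+ card V) ⁴ ℤ.* (P ℤ.* P ℤ.* P ℤ.* M))   ≡⟨ cong (ℕtoℚ 16 *_) (trans (ℤtoℚ-* ((+ card V) ⁴) (P ℤ.* P ℤ.* P ℤ.* M))
                                                                     (cong₂ _*_ (ℤtoℚ-⁴ (+ card V))
                                                                       (trans (ℤtoℚ-* (P ℤ.* P ℤ.* P) M) (cong (_* ℤtoℚ M) ℤtoℚ-P³)))) ⟩
      ℕtoℚ 16 * (pow4 v * (P³ * ℤtoℚ M))                        ∎
    N≡vh : Nq ≡ v * h
    N≡vh = trans (cong (ℤtoℚ ∘ +_) (sym card-V*card-V⊥))
                 (trans (cong ℤtoℚ (ℤₚ.pos-* (card V) (card V⊥))) (ℤtoℚ-* (+ card V) (+ card V⊥)))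
    0<v⁴P³ : 0ℚ < pow4 v * P³
    0<v⁴P³ = ℚₚ.positive⁻¹ (pow4 v * P³) {{ℚₚ.pos*pos⇒pos (pow4 v) {{ℚ.positive (pow4-pos 0<v)}} P³ {{P³>0}}}}
      where
      0<v : 0ℚ < v
      0<v = ℤtoℚ-mono-< {0ℤ} {+ card V} (+<+ card-V>0)
      0<Pq : 0ℚ < Pq
      0<Pq = ℤtoℚ-mono-< {0ℤ} {+ (card A₁ ℕ.* card A₂ ℕ.* card A₃ ℕ.* card A₄)}
               (+<+ (ℕₚ.*-mono-≤ (ℕₚ.*-mono-≤ (ℕₚ.*-mono-≤ A₁≢∅ A₂≢∅) A₃≢∅) A₄≢∅))
      P³>0 : ℚ.Positive P³
      P³>0 = ℚₚ.pos*pos⇒pos (Pq * Pq) {{ℚₚ.pos*pos⇒pos Pq {{ℚ.positive 0<Pq}} Pq {{ℚ.positive 0<Pq}}}} Pq {{ℚ.positive 0<Pq}}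

open import Data.Rational using (_≤_; _*_; _/_)

proposition2p4 : (n : ℕ) (K : ℚ) → 1ℚ ≤ K
    → (A₁ A₂ A₃ A₄ : Subset n)
    → NonEmpty A₁ → NonEmpty A₂ → NonEmpty A₃ → NonEmpty A₄
    → (δ² : ℚ) → δ² * ((+ 2 / 1) * K) ≡ 1ℚ
    → CoherentlyFlat² δ² A₁ A₂ A₃ A₄
    → ωAtLeastInv K A₁ A₂ A₃ A₄
    → Σ (Subset n) λ H → IsSubspace H
      × (256 ℕ.* (card A₁ ℕ.* card A₂ ℕ.* card A₃ ℕ.* card A₄)
           ℕ.≤ 625 ℕ.* (card H ℕ.* card H ℕ.* card H ℕ.* card H))
      × Σ (𝔽₂^ n) λ x₁ → Σ (𝔽₂^ n) λ x₂ → Σ (𝔽₂^ n) λ x₃ → Σ (𝔽₂^ n) λ x₄ →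
          pow4 (ℕtoℚ (card H))
            ≤ pow4 ((+ 2 / 1) * K)
              * ℕtoℚ (card (interCoset A₁ x₁ H) ℕ.* card (interCoset A₂ x₂ H)
                      ℕ.* card (interCoset A₃ x₃ H) ℕ.* card (interCoset A₄ x₄ H))
proposition2p4 n K 1≤K A₁ A₂ A₃ A₄ A₁≢∅ A₂≢∅ A₃≢∅ A₄≢∅ δ² δ²[2K]≡1 flat ω≥1/K =
  V⊥ , V⊥-isSubspace , size-bound A₁≢∅ A₂≢∅ A₃≢∅ A₄≢∅ ,
  densest-coset A₁ , densest-coset A₂ , densest-coset A₃ , densest-coset A₄ ,
  coset-bound A₁≢∅ A₂≢∅ A₃≢∅ A₄≢∅ ω≥1/K
  where open Proposition K 1≤K A₁ A₂ A₃ A₄ δ² δ²[2K]≡1 flat
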